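{- Let $G$ be a caterpillar-wheel of girth at least $3$. Then $G$ is $\alpha$-excellent if and only if either $G$ is a cycle (a caterpillar-wheel with no leg), or $G$ has a perfect matching and has at least two legs.
   Context: All graphs are finite and simple. A graph is $\alpha$-excellent if every vertex is contained in some maximum independent set. A caterpillar-wheel is a connected unicyclic graph of girth at least three in which at least one end of every edge lies on the unique cycle $C$. An end-edge (an edge incident with a vertex of degree $1$) of a caterpillar-wheel is called a leg. -}

module Defs where

open import Data.Nat using (ℕ; _≤_)
open import Data.Bool using (Bool; true; false)
open import Data.Fin using (Fin)
open import Data.Fin.Subset using (Subset; _∈_; ∣_∣)
open import Data.Vec using (tabulate)
open import Data.Product using (_×_; ∃; ∃-syntax; Σ-syntax)
open import Data.Sum using (_⊎_)
open import Relation.Nullary using (¬_)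
open import Relation.Binary.PropositionalEquality using (_≡_)

Rel₂ : ℕ → Set
Rel₂ n = Fin n → Fin n → Bool

record Graph (n : ℕ) : Set where
  field
    adj    : Rel₂ n
    sym    : ∀ u v → adj u v ≡ adj v u
    irrefl : ∀ v → adj v v ≡ false
open Graph public

deg : {n : ℕ} → Rel₂ n → Fin n → ℕ
deg E v = ∣ tabulate (E v) ∣

data Walk {n : ℕ} (E : Rel₂ n) : Fin n → Fin n → Set where
  here : ∀ {v} → Walk E v v
  step : ∀ {u v w} → E u v ≡ true → Walk E v w → Walk E u w

Connected : {n : ℕ} → Graph n → Set
Connected G = ∀ u v → Walk (adj G) u v

record SubEdges {n : ℕ} (G : Graph n) (H : Rel₂ n) : Set where
  field
    symH : ∀ u v → H u v ≡ H v u
    subH : ∀ u v → H u v ≡ true → adj G u v ≡ true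

record IsCycle {n : ℕ} (G : Graph n) (H : Rel₂ n) : Set where
  field
    sub      : SubEdges G H
    nonempty : ∃[ u ] ∃[ v ] H u v ≡ true
    deg02    : ∀ v → deg H v ≡ 0 ⊎ deg H v ≡ 2
    conn     : ∀ u v → ¬ (deg H u ≡ 0) → ¬ (deg H v ≡ 0) → Walk H u v

SameEdges : {n : ℕ} → Rel₂ n → Rel₂ n → Set
SameEdges H H' = ∀ u v → H u v ≡ H' u v

OnCycle : {n : ℕ} → Rel₂ n → Fin n → Set
OnCycle C v = ∃[ w ] C v w ≡ true

-- G is a caterpillar-wheel with unique cycle C: G connected, C is a cycle of G,
-- every cycle of G equals C (unicyclic), and every edge has an end on C.
-- (Girth ≥ 3 is automatic for simple graphs.)
record CaterpillarWheel {n : ℕ} (G : Graph n) (C : Rel₂ n) : Set where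
  field
    connected : Connected G
    cycle     : IsCycle G C
    unique    : ∀ C' → IsCycle G C' → SameEdges C' C
    edgeOnC   : ∀ u v → adj G u v ≡ true → OnCycle C u ⊎ OnCycle C v

Independent : {n : ℕ} → Graph n → Subset n → Set
Independent G S = ∀ u v → u ∈ S → v ∈ S → adj G u v ≡ false

MaximumIndependent : {n : ℕ} → Graph n → Subset n → Set
MaximumIndependent G S = Independent G S × (∀ T → Independent G T → ∣ T ∣ ≤ ∣ S ∣)

AlphaExcellent : {n : ℕ} → Graph n → Set
AlphaExcellent G = ∀ v → ∃[ S ] (MaximumIndependent G S × v ∈ S)

HasPerfectMatching : {n : ℕ} → Graph n → Set
HasPerfectMatching G = ∃[ M ] (SubEdges G M × (∀ v → deg M v ≡ 1))

IsLeg : {n : ℕ} → Graph n → Fin n → Fin n → Set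
IsLeg G u v = adj G u v ≡ true × (deg (adj G) u ≡ 1 ⊎ deg (adj G) v ≡ 1)

NoLeg : {n : ℕ} → Graph n → Set
NoLeg G = ∀ u v → ¬ IsLeg G u v

-- At least two distinct legs (edges as unordered pairs).
AtLeastTwoLegs : {n : ℕ} → Graph n → Set
AtLeastTwoLegs G = ∃[ u ] ∃[ v ] ∃[ u' ] ∃[ v' ]
  (IsLeg G u v × IsLeg G u' v' × ¬ (u ≡ u' × v ≡ v') × ¬ (u ≡ v' × v ≡ u'))

{-# OPTIONS --safe #-}
-- Every vertex off C is a leaf hanging from C, and C has no chords, so G is C with pendant legs.
-- Without legs G = C; listing C as x 0, x 1 = v, …, x (k - 1), the odd-indexed vertices form an
-- independent set of the maximum size ⌊ k /2⌋.
-- If M is a perfect matching, no independent set has more than n / 2 vertices, so one meeting every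
-- M-edge exactly once is maximum. Such a set containing v is obtained by walking around C and keeping
-- the leaves and the cycle vertices matched to their successor; when v is matched to a leaf, a second
-- leg lets the walk keep predecessors instead up to the next legged vertex.
-- Conversely, let G be α-excellent with a leg. Exchanging parts of a maximum independent set shows that
-- no cycle vertex carries two leaves, that a second cycle vertex carries a leaf, and that consecutive
-- legged cycle vertices are separated by an even number of leafless ones. Matching every legged vertex
-- with its leaf and the leafless stretches in consecutive pairs gives a perfect matching.

module Submission where

open import Defs hiding (sym)
open import Data.Nat using (ℕ; zero; suc; _+_; _∸_; _≤_; _<_; z≤n; s≤s; _≤?_; _<?_; ⌊_/2⌋)
open import Data.Nat.Properties hiding (_≟_)
open import Data.Bool using (Bool; true; false; _∧_; _∨_; not)
open import Data.Bool.Properties using (¬-not)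
import Data.Bool.Properties as BP
open import Data.Fin using (Fin; zero; suc; toℕ)
open import Data.Fin.Properties using (_≟_; any?; pigeonhole)
open import Data.Fin.Subset using (Subset; _∈_; ∣_∣)
open import Data.Fin.Permutation using (permutation)
open import Data.Vec using (Vec; []; _∷_; tabulate; lookup)
open import Data.Vec.Properties using (lookup∘tabulate; []=⇒lookup; lookup⇒[]=)
open import Data.Product using (_×_; _,_; ∃; ∃-syntax; Σ-syntax; proj₁; proj₂; uncurry)
open import Data.Sum using (_⊎_; inj₁; inj₂; [_,_]′)
open import Data.Empty using (⊥; ⊥-elim)
open import Relation.Nullary using (¬_; Dec; yes; no; does)
open import Relation.Nullary.Decidable using (_×-dec_; ¬?; dec-true; dec-false)
open import Relation.Binary using (tri<; tri≈; tri>)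
open import Relation.Binary.PropositionalEquality
open import Function.Bundles using (_⇔_; mk⇔)
import Algebra.Properties.CommutativeMonoid.Sum as SumP
open import Algebra.Properties.CommutativeSemigroup +-commutativeSemigroup using (interchange)

true≢false : true ≡ false → ⊥
true≢false ()

bit : Bool → ℕ
bit true = 1
bit false = 0

bit≤1 : ∀ b → bit b ≤ 1
bit≤1 true = s≤s z≤n
bit≤1 false = z≤n

count : ∀ {n} → (Fin n → Bool) → ℕ
count {zero} f = 0
count {suc n} f = bit (f zero) + count (λ i → f (suc i))

eqb : ∀ {n} → Fin n → Fin n → Bool
eqb a b = does (a ≟ b)

eqb-true : ∀ {n} {a b : Fin n} → eqb a b ≡ true → a ≡ b
eqb-true {a = a} {b} e with a ≟ b
... | yes p = p
... | no _ = ⊥-elim (true≢false (sym e))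

eqb-refl : ∀ {n} (a : Fin n) → eqb a a ≡ true
eqb-refl a with a ≟ a
... | yes _ = refl
... | no q = ⊥-elim (q refl)

eqb-false : ∀ {n} {a b : Fin n} → ¬ a ≡ b → eqb a b ≡ false
eqb-false {a = a} {b} ne with a ≟ b
... | yes p = ⊥-elim (ne p)
... | no _ = refl

≡⇒eqb : ∀ {n} {a b : Fin n} → a ≡ b → eqb a b ≡ true
≡⇒eqb {a = a} refl = eqb-refl a

eqb-sym : ∀ {n} (a b : Fin n) → eqb a b ≡ eqb b a
eqb-sym a b with a ≟ b | b ≟ a
... | yes _ | yes _ = refl
... | no _ | no _ = refl
... | yes p | no q = ⊥-elim (q (sym p))
... | no q | yes p = ⊥-elim (q (sym p))

∧-true₁ : ∀ {a b} → a ∧ b ≡ true → a ≡ true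
∧-true₁ {true} e = refl
∧-true₂ : ∀ {a b} → a ∧ b ≡ true → b ≡ true
∧-true₂ {true} e = e
∧-intro : ∀ {a b} → a ≡ true → b ≡ true → a ∧ b ≡ true
∧-intro refl refl = refl
∨-elim : ∀ {a b} → a ∨ b ≡ true → a ≡ true ⊎ b ≡ true
∨-elim {true} e = inj₁ refl
∨-elim {false} e = inj₂ e
∨-introl : ∀ {a b} → a ≡ true → a ∨ b ≡ true
∨-introl refl = refl
∨-intror : ∀ {a b} → b ≡ true → a ∨ b ≡ true
∨-intror {true} e = refl
∨-intror {false} e = e
not-true : ∀ {a} → not a ≡ true → a ≡ false
not-true {false} _ = refl
not-false : ∀ {a} → a ≡ false → not a ≡ true
not-false refl = refl
not-false⁻¹ : ∀ {a} → not a ≡ false → a ≡ true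
not-false⁻¹ {true} _ = refl

bool-ext : ∀ {a b : Bool} → (a ≡ true → b ≡ true) → (b ≡ true → a ≡ true) → a ≡ b
bool-ext {true} {true} f g = refl
bool-ext {true} {false} f g = sym (f refl)
bool-ext {false} {true} f g = g refl
bool-ext {false} {false} f g = refl

bit-true : ∀ {a} → a ≡ true → (m : ℕ) → bit a + m ≡ suc m
bit-true refl m = refl

count-ext : ∀ {n} {f g : Fin n → Bool} → (∀ z → f z ≡ g z) → count f ≡ count g
count-ext {zero} h = refl
count-ext {suc n} h = cong₂ _+_ (cong bit (h zero)) (count-ext (λ z → h (suc z)))

count-≤ : ∀ {n} (f : Fin n → Bool) → count f ≤ n
count-≤ {zero} f = z≤n
count-≤ {suc n} f = +-mono-≤ (bit≤1 (f zero)) (count-≤ (λ z → f (suc z)))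

count-split : ∀ {n} (f g : Fin n → Bool) → count f ≡ count (λ z → f z ∧ g z) + count (λ z → f z ∧ not (g z))
count-split {zero} f g = refl
count-split {suc n} f g with f zero | g zero
... | true | true = cong suc (count-split (λ i → f (suc i)) (λ i → g (suc i)))
... | true | false = trans (cong suc (count-split (λ i → f (suc i)) (λ i → g (suc i)))) (sym (+-suc _ _))
... | false | true = count-split (λ i → f (suc i)) (λ i → g (suc i))
... | false | false = count-split (λ i → f (suc i)) (λ i → g (suc i))

count-not : ∀ {n} (f : Fin n → Bool) → count f + count (λ z → not (f z)) ≡ n
count-not {zero} f = refl
count-not {suc n} f with f zero
... | true = cong suc (count-not (λ i → f (suc i)))
... | false = trans (+-suc _ _) (cong suc (count-not (λ i → f (suc i))))

count-zero : ∀ {n} {f : Fin n → Bool} → (∀ z → f z ≡ false) → count f ≡ 0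
count-zero {zero} h = refl
count-zero {suc n} {f} h rewrite h zero = count-zero (λ z → h (suc z))

count-pos : ∀ {n} {f : Fin n → Bool} (a : Fin n) → f a ≡ true → 1 ≤ count f
count-pos {suc n} {f} zero e rewrite e = s≤s z≤n
count-pos {suc n} {f} (suc a) e = ≤-trans (count-pos a e) (m≤n+m _ (bit (f zero)))

count-0→ : ∀ {n} {f : Fin n → Bool} → count f ≡ 0 → ∀ a → f a ≡ false
count-0→ {f = f} e a = ¬-not (λ fa → n≮0 (subst (1 ≤_) e (count-pos a fa)))

count-or : ∀ {n} (f g : Fin n → Bool) → (∀ z → f z ≡ true → g z ≡ false) →
  count (λ z → f z ∨ g z) ≡ count f + count g
count-or f g d = trans (count-split (λ z → f z ∨ g z) f)
  (cong₂ _+_ (count-ext (λ z → l1 (f z) (g z))) (count-ext (λ z → l2 (f z) (g z) (d z))))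
  where l1 : ∀ a b → (a ∨ b) ∧ a ≡ a
        l1 true b = refl
        l1 false true = refl
        l1 false false = refl
        l2 : ∀ a b → (a ≡ true → b ≡ false) → (a ∨ b) ∧ not a ≡ b
        l2 true b k = sym (k refl)
        l2 false true k = refl
        l2 false false k = refl

count-disj : ∀ {n} (f g : Fin n → Bool) → (∀ z → f z ≡ true → g z ≡ false) → count f + count g ≤ n
count-disj {n} f g d = subst (λ w → w ≤ n) (count-or f g d) (count-≤ (λ z → f z ∨ g z))

count-point : ∀ {n} (a : Fin n) → count (λ z → eqb z a) ≡ 1
count-point {suc n} zero = cong suc (count-zero {n} {f = λ z → eqb (suc z) zero} (λ z → eqb-false {a = suc z} {zero} (λ ())))
count-point {suc n} (suc a) = trans (count-ext {f = λ z → eqb (suc z) (suc a)} (λ z → aux z)) (count-point a)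
  where aux : ∀ z → eqb (suc z) (suc a) ≡ eqb z a
        aux z with z ≟ a
        ... | yes refl = refl
        ... | no q = refl

count-one : ∀ {n} {f : Fin n → Bool} (a : Fin n) → f a ≡ true → (∀ z → f z ≡ true → z ≡ a) → count f ≡ 1
count-one {f = f} a fa h = trans (count-ext aux) (count-point a)
  where aux : ∀ z → f z ≡ eqb z a
        aux z = bool-ext (λ fz → subst (λ w → eqb w a ≡ true) (sym (h z fz)) (eqb-refl a))
                         (λ e → subst (λ w → f w ≡ true) (sym (eqb-true e)) fa)

count-at : ∀ {n} (f : Fin n → Bool) (a : Fin n) → count (λ z → f z ∧ eqb z a) ≡ bit (f a)
count-at f a with f a in fa
... | true = count-one {f = λ z → f z ∧ eqb z a} a (∧-intro fa (eqb-refl a)) (λ z e → eqb-true (∧-true₂ e))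
... | false = count-zero {f = λ z → f z ∧ eqb z a} (λ z → ¬-not λ e → true≢false (trans (sym (subst (λ w → f w ≡ true) (eqb-true (∧-true₂ e)) (∧-true₁ e))) fa))

count-remove : ∀ {n} (f : Fin n → Bool) (a : Fin n) → count f ≡ bit (f a) + count (λ z → f z ∧ not (eqb z a))
count-remove f a = trans (count-split f (λ z → eqb z a)) (cong (λ w → w + count (λ z → f z ∧ not (eqb z a))) (count-at f a))

count≡1⇒unique : ∀ {n} {f : Fin n → Bool} → count f ≡ 1 → ∀ {a b} → f a ≡ true → f b ≡ true → a ≡ b
count≡1⇒unique {f = f} e {a} {b} fa fb with a ≟ b
... | yes p = p
... | no q = ⊥-elim (1+n≰n (subst (2 ≤_) e' (+-mono-≤ (≤-refl {1}) (count-pos b (∧-intro fb (not-false (eqb-false (λ x → q (sym x)))))))))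
  where e' : 1 + count (λ z → f z ∧ not (eqb z a)) ≡ 1
        e' = trans (sym (bit-true fa _)) (trans (sym (count-remove f a)) e)

count≡2⇒third : ∀ {n} {f : Fin n → Bool} → count f ≡ 2 → ∀ {a b c} → f a ≡ true → f b ≡ true → ¬ a ≡ b → f c ≡ true → c ≡ a ⊎ c ≡ b
count≡2⇒third {n} {f} e {a} {b} {c} fa fb ab fc with c ≟ a | c ≟ b
... | yes p | _ = inj₁ p
... | no _ | yes p = inj₂ p
... | no ca | no cb = ⊥-elim (1+n≰n (subst (3 ≤_) e (subst (3 ≤_) (sym eq) (s≤s (s≤s (count-pos c g))))))
  where f' f'' : Fin n → Bool
        f' z = f z ∧ not (eqb z a)
        f'' z = f' z ∧ not (eqb z b)
        eq : count f ≡ 1 + (1 + count f'')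
        eq = trans (count-remove f a) (trans (bit-true fa _)
               (cong suc (trans (count-remove f' b) (bit-true {f' b} (∧-intro fb (not-false (eqb-false (λ x → ab (sym x))))) _))))
        g : f'' c ≡ true
        g = ∧-intro (∧-intro fc (not-false (eqb-false ca))) (not-false (eqb-false cb))

count-exists : ∀ {n} (f : Fin n → Bool) → 1 ≤ count f → ∃[ a ] f a ≡ true
count-exists {suc n} f h with f zero in e
... | true = zero , e
... | false = let (a , p) = count-exists (λ z → f (suc z)) h in suc a , p

count≡2⇒other : ∀ {n} {f : Fin n → Bool} → count f ≡ 2 → ∀ {a} → f a ≡ true → ∃[ b ] (¬ b ≡ a × f b ≡ true)
count≡2⇒other {n} {f} e {a} fa =
  let (b , fb) = count-exists f' h in
  b , (λ ba → true≢false (trans (sym (∧-true₂ fb)) (cong not (subst (λ w → eqb w a ≡ true) (sym ba) (eqb-refl a))))) , ∧-true₁ fb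
  where f' : Fin n → Bool
        f' z = f z ∧ not (eqb z a)
        e' : 1 + count f' ≡ 2
        e' = trans (sym (bit-true fa _)) (trans (sym (count-remove f a)) e)
        h : 1 ≤ count f'
        h = ≤-reflexive (sym (suc-injective e'))

count-two : ∀ {n} {f : Fin n → Bool} (a b : Fin n) → ¬ a ≡ b → f a ≡ true → f b ≡ true → (∀ z → f z ≡ true → z ≡ a ⊎ z ≡ b) → count f ≡ 2
count-two {f = f} a b ab fa fb h = trans (count-remove f a) (trans (bit-true fa _)
   (cong suc (count-one b (∧-intro fb (not-false (eqb-false (λ x → ab (sym x))))) aux)))
  where aux : ∀ z → f z ∧ not (eqb z a) ≡ true → z ≡ b
        aux z e with h z (∧-true₁ e)
        ... | inj₂ p = p
        ... | inj₁ p = ⊥-elim (true≢false (trans (sym (∧-true₂ e)) (cong not (subst (λ w → eqb w a ≡ true) (sym p) (eqb-refl a)))))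

card-tab : ∀ {n} (f : Fin n → Bool) → ∣ tabulate f ∣ ≡ count f
card-tab {zero} f = refl
card-tab {suc n} f with f zero
... | true = cong suc (card-tab (λ i → f (suc i)))
... | false = card-tab (λ i → f (suc i))

card-vec : ∀ {n} (S : Subset n) → ∣ S ∣ ≡ count (lookup S)
card-vec [] = refl
card-vec (true ∷ S) = cong suc (card-vec S)
card-vec (false ∷ S) = card-vec S

∈-tab : ∀ {n} {f : Fin n → Bool} {z} → z ∈ tabulate f → f z ≡ true
∈-tab {f = f} {z} m = trans (sym (lookup∘tabulate f z)) ([]=⇒lookup m)

tab-∈ : ∀ {n} {f : Fin n → Bool} {z} → f z ≡ true → z ∈ tabulate f
tab-∈ {f = f} {z} e = lookup⇒[]= z (tabulate f) (trans (lookup∘tabulate f z) e)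

∈-vec : ∀ {n} {S : Subset n} {z} → z ∈ S → lookup S z ≡ true
∈-vec = []=⇒lookup

vec-∈ : ∀ {n} {S : Subset n} {z} → lookup S z ≡ true → z ∈ S
vec-∈ {S = S} {z} = lookup⇒[]= z S

module ℕ-sum = SumP +-0-commutativeMonoid

count-sum : ∀ {n} (f : Fin n → Bool) → count f ≡ ℕ-sum.sum (λ i → bit (f i))
count-sum {zero} f = refl
count-sum {suc n} f = cong (bit (f zero) +_) (count-sum (λ i → f (suc i)))

count-involution : ∀ {n} (p : Fin n → Fin n) → (∀ z → p (p z) ≡ z) → (f : Fin n → Bool) → count (λ z → f (p z)) ≡ count f
count-involution p inv f = trans (count-sum (λ z → f (p z))) (trans (sym (ℕ-sum.sum-permute (λ i → bit (f i)) (permutation p p inv inv))) (sym (count-sum f)))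

sumBelow : ℕ → (ℕ → ℕ) → ℕ
sumBelow zero g = 0
sumBelow (suc m) g = sumBelow m g + g m

anyBelow : ℕ → (ℕ → Bool) → Bool
anyBelow zero p = false
anyBelow (suc m) p = anyBelow m p ∨ p m

anyBelow-intro : ∀ {m} (p : ℕ → Bool) t → t < m → p t ≡ true → anyBelow m p ≡ true
anyBelow-intro {suc m} p t (s≤s t≤m) e with m≤n⇒m<n∨m≡n t≤m
... | inj₁ lt = ∨-introl (anyBelow-intro p t lt e)
... | inj₂ refl = ∨-intror {anyBelow t p} e

anyBelow-elim : ∀ {m} (p : ℕ → Bool) → anyBelow m p ≡ true → ∃[ t ] (t < m × p t ≡ true)
anyBelow-elim {suc m} p e with ∨-elim {anyBelow m p} e
... | inj₁ e' = let (t , lt , q) = anyBelow-elim p e' in t , m<n⇒m<1+n lt , q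
... | inj₂ e' = m , ≤-refl , e'

odd : ℕ → Bool
odd zero = false
odd (suc t) = not (odd t)

ltᵇ : ℕ → ℕ → Bool
ltᵇ a b = does (a <? b)

ltᵇ-yes : ∀ {a b} → a < b → ltᵇ a b ≡ true
ltᵇ-yes {a} {b} = dec-true (a <? b)

ltᵇ-no : ∀ {a b} → ¬ a < b → ltᵇ a b ≡ false
ltᵇ-no {a} {b} = dec-false (a <? b)

sumBelow-ext : ∀ m {g h : ℕ → ℕ} → (∀ t → t < m → g t ≡ h t) → sumBelow m g ≡ sumBelow m h
sumBelow-ext zero e = refl
sumBelow-ext (suc m) e = cong₂ _+_ (sumBelow-ext m (λ t lt → e t (m<n⇒m<1+n lt))) (e m ≤-refl)

sumBelow-shift : ∀ m (g : ℕ → ℕ) → sumBelow (suc m) g ≡ g 0 + sumBelow m (λ t → g (suc t))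
sumBelow-shift zero g = +-comm 0 (g 0)
sumBelow-shift (suc m) g = trans (cong (_+ g (suc m)) (sumBelow-shift m g)) (+-assoc (g 0) _ _)

sumBelow-add : ∀ a b (g : ℕ → ℕ) → sumBelow (a + b) g ≡ sumBelow a g + sumBelow b (λ t → g (a + t))
sumBelow-add a zero g = trans (cong (λ w → sumBelow w g) (+-identityʳ a)) (sym (+-identityʳ _))
sumBelow-add a (suc b) g = trans (cong (λ w → sumBelow w g) (+-suc a b))
  (trans (cong (_+ g (a + b)) (sumBelow-add a b g)) (+-assoc (sumBelow a g) _ _))

sumBelow-+ : ∀ m (g h : ℕ → ℕ) → sumBelow m (λ t → g t + h t) ≡ sumBelow m g + sumBelow m h
sumBelow-+ zero g h = refl
sumBelow-+ (suc m) g h = trans (cong (_+ (g m + h m)) (sumBelow-+ m g h)) (interchange (sumBelow m g) (sumBelow m h) (g m) (h m))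

sumBelow-≤ : ∀ m (g : ℕ → ℕ) → (∀ t → t < m → g t ≤ 1) → sumBelow m g ≤ m
sumBelow-≤ zero g h = z≤n
sumBelow-≤ (suc m) g h = subst (sumBelow (suc m) g ≤_) (+-comm m 1) (+-mono-≤ (sumBelow-≤ m g (λ t lt → h t (m<n⇒m<1+n lt))) (h m ≤-refl))

sumBelow-rotate : ∀ m (g : ℕ → ℕ) → g m ≡ g 0 → sumBelow m (λ t → g (suc t)) ≡ sumBelow m g
sumBelow-rotate m g e = +-cancelʳ-≡ (g 0) _ _ (trans (+-comm _ (g 0)) (trans (sym (sumBelow-shift m g)) (cong (sumBelow m g +_) e)))

sumBelow-odd : ∀ m → sumBelow m (λ t → bit (odd t)) ≡ ⌊ m /2⌋
sumBelow-odd zero = refl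
sumBelow-odd (suc zero) = refl
sumBelow-odd (suc (suc m)) = begin
  sumBelow m (λ t → bit (odd t)) + bit (odd m) + bit (odd (suc m))
    ≡⟨ +-assoc (sumBelow m (λ t → bit (odd t))) _ _ ⟩
  sumBelow m (λ t → bit (odd t)) + (bit (odd m) + bit (not (odd m)))
    ≡⟨ cong₂ _+_ (sumBelow-odd m) (bit+bit-not (odd m)) ⟩
  ⌊ m /2⌋ + 1
    ≡⟨ +-comm ⌊ m /2⌋ 1 ⟩
  suc ⌊ m /2⌋ ∎
  where
  open ≡-Reasoning
  bit+bit-not : ∀ b → bit b + bit (not b) ≡ 1
  bit+bit-not true = refl
  bit+bit-not false = refl

m+m≤n⇒m≤⌊n/2⌋ : ∀ m n → m + m ≤ n → m ≤ ⌊ n /2⌋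
m+m≤n⇒m≤⌊n/2⌋ m n h = subst (_≤ ⌊ n /2⌋) (sym (n≡⌊n+n/2⌋ m)) (⌊n/2⌋-mono h)

pathIndependentBound-step : ∀ m (h : ℕ → Bool) → (∀ t → suc t < suc (suc m) → h t ≡ true → h (suc t) ≡ false) →
  sumBelow (suc m) (λ t → bit (h t)) ≤ ⌊ suc (suc m) /2⌋ →
  sumBelow m (λ t → bit (h t)) ≤ ⌊ suc m /2⌋ →
  ∀ a b → h m ≡ a → h (suc m) ≡ b →
  sumBelow m (λ t → bit (h t)) + bit (h m) + bit (h (suc m)) ≤ ⌊ suc (suc (suc m)) /2⌋
pathIndependentBound-step m h H P Q a false _ e1 rewrite e1 = ≤-trans (≤-reflexive (+-identityʳ _)) (≤-trans P (⌊n/2⌋-mono (n≤1+n _)))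
pathIndependentBound-step m h H P Q false true e0 e1 rewrite e0 | e1 = ≤-trans (≤-reflexive (trans (+-assoc (sumBelow m (λ t → bit (h t))) 0 1) (+-comm _ 1))) (s≤s Q)
pathIndependentBound-step m h H P Q true true e0 e1 = ⊥-elim (true≢false (trans (sym e1) (H m ≤-refl e0)))

pathIndependentBound : ∀ m (h : ℕ → Bool) → (∀ t → suc t < m → h t ≡ true → h (suc t) ≡ false) →
  sumBelow m (λ t → bit (h t)) ≤ ⌊ suc m /2⌋
pathIndependentBound zero h H = z≤n
pathIndependentBound (suc zero) h H = bit≤1 (h 0)
pathIndependentBound (suc (suc m)) h H = pathIndependentBound-step m h H (pathIndependentBound (suc m) h (λ t lt → H t (m<n⇒m<1+n lt)))
  (pathIndependentBound m h (λ t lt → H t (m<n⇒m<1+n (m<n⇒m<1+n lt)))) (h m) (h (suc m)) refl refl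

module _ {n : ℕ} where

  inRange : (ℕ → Fin n) → ℕ → Fin n → Bool
  inRange e m z = anyBelow m (λ t → eqb (e t) z)

  Distinct : (ℕ → Fin n) → ℕ → Set
  Distinct e m = ∀ i j → i < m → j < m → e i ≡ e j → i ≡ j

  inRange-intro : ∀ (e : ℕ → Fin n) {m} t → t < m → inRange e m (e t) ≡ true
  inRange-intro e t lt = anyBelow-intro (λ s → eqb (e s) (e t)) t lt (eqb-refl (e t))

  inRange-elim : ∀ (e : ℕ → Fin n) {m} z → inRange e m z ≡ true → ∃[ t ] (t < m × e t ≡ z)
  inRange-elim e z h = let (t , lt , q) = anyBelow-elim _ h in t , lt , eqb-true q

  inRange-false : ∀ {e : ℕ → Fin n} {m z} → inRange e m z ≡ false → ∀ t → t < m → ¬ e t ≡ z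
  inRange-false {e = e} {m = m} {z} h t lt q = true≢false (trans (sym (subst (λ w → inRange e m w ≡ true) q (inRange-intro e t lt))) h)

  count∧inRange≡sum : ∀ (e : ℕ → Fin n) m → Distinct e m → (f : Fin n → Bool) →
    count (λ z → f z ∧ inRange e m z) ≡ sumBelow m (λ t → bit (f (e t)))
  count∧inRange≡sum e zero D f = count-zero (λ z → BP.∧-zeroʳ (f z))
  count∧inRange≡sum e (suc m) D f = begin
    count (λ z → f z ∧ (inRange e m z ∨ eqb (e m) z))
      ≡⟨ count-ext (λ z → trans (BP.∧-distribˡ-∨ (f z) (inRange e m z) (eqb (e m) z)) (cong (λ w → (f z ∧ inRange e m z) ∨ (f z ∧ w)) (eqb-sym (e m) z))) ⟩
    count (λ z → (f z ∧ inRange e m z) ∨ (f z ∧ eqb z (e m)))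
      ≡⟨ count-or (λ z → f z ∧ inRange e m z) (λ z → f z ∧ eqb z (e m)) disj ⟩
    count (λ z → f z ∧ inRange e m z) + count (λ z → f z ∧ eqb z (e m))
      ≡⟨ cong₂ _+_ (count∧inRange≡sum e m (λ i j li lj → D i j (m<n⇒m<1+n li) (m<n⇒m<1+n lj)) f) (count-at f (e m)) ⟩
    sumBelow m (λ t → bit (f (e t))) + bit (f (e m)) ∎
    where
    open ≡-Reasoning
    disj : ∀ z → f z ∧ inRange e m z ≡ true → f z ∧ eqb z (e m) ≡ false
    disj z h = ¬-not λ h2 → let (t , lt , q) = inRange-elim e {m} z (∧-true₂ h) in
      <-irrefl (D t m (m<n⇒m<1+n lt) ≤-refl (trans q (eqb-true (∧-true₂ h2)))) lt

  count≡sum : ∀ (e : ℕ → Fin n) m → Distinct e m → (f : Fin n → Bool) →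
    (∀ z → f z ≡ true → inRange e m z ≡ true) → count f ≡ sumBelow m (λ t → bit (f (e t)))
  count≡sum e m D f H = trans (count-ext (λ z → l (f z) (inRange e m z) (H z))) (count∧inRange≡sum e m D f)
    where l : ∀ a b → (a ≡ true → b ≡ true) → a ≡ a ∧ b
          l true b k = sym (k refl)
          l false b k = refl

  exchange-count : ∀ (e : ℕ → Fin n) m → Distinct e m → (S T : Fin n → Bool) →
    (∀ z → inRange e m z ≡ false → S z ≡ T z) →
    count T + sumBelow m (λ t → bit (S (e t))) ≡ count S + sumBelow m (λ t → bit (T (e t)))
  exchange-count e m D S T H = begin
    count T + ΣS
      ≡⟨ cong (_+ ΣS) (trans (count-split T (inRange e m)) (cong (_+ restT) (count∧inRange≡sum e m D T))) ⟩
    (ΣT + restT) + ΣS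
      ≡⟨ cong (λ w → (ΣT + w) + ΣS) (sym restEq) ⟩
    (ΣT + restS) + ΣS
      ≡⟨ l ΣT restS ΣS ⟩
    (ΣS + restS) + ΣT
      ≡⟨ cong (_+ ΣT) (sym (trans (count-split S (inRange e m)) (cong (_+ restS) (count∧inRange≡sum e m D S)))) ⟩
    count S + ΣT ∎
    where
    open ≡-Reasoning
    ΣS ΣT restS restT : ℕ
    ΣS = sumBelow m (λ t → bit (S (e t)))
    ΣT = sumBelow m (λ t → bit (T (e t)))
    restS = count (λ z → S z ∧ not (inRange e m z))
    restT = count (λ z → T z ∧ not (inRange e m z))
    restEq : restS ≡ restT
    restEq = count-ext λ z → ll z (inRange e m z) refl
      where ll : ∀ z b → inRange e m z ≡ b → S z ∧ not b ≡ T z ∧ not b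
            ll z true _ = trans (BP.∧-zeroʳ (S z)) (sym (BP.∧-zeroʳ (T z)))
            ll z false q = cong (_∧ true) (H z q)
    l : ∀ a b c → (a + b) + c ≡ (c + b) + a
    l a b c = trans (+-comm (a + b) c) (trans (cong (c +_) (+-comm a b)) (sym (+-assoc c b a)))

module GraphLemmas {n : ℕ} (G : Graph n) where

  adj⇒≢ : ∀ {u v} → adj G u v ≡ true → ¬ u ≡ v
  adj⇒≢ {u} e refl = true≢false (trans (sym e) (irrefl G u))

  adj-symmetric : ∀ {u v} → adj G u v ≡ true → adj G v u ≡ true
  adj-symmetric {u} {v} e = trans (Graph.sym G v u) e

  module CycleOfSequence (y : ℕ → Fin n) (m : ℕ) (m≥3 : 3 ≤ m) (D : Distinct y m) (wrap : y m ≡ y 0)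
             (ad : ∀ t → t < m → adj G (y t) (y (suc t)) ≡ true) where

    hp : Fin n → Fin n → ℕ → Bool
    hp u v t = (eqb (y t) u ∧ eqb (y (suc t)) v) ∨ (eqb (y (suc t)) u ∧ eqb (y t) v)

    H : Rel₂ n
    H u v = anyBelow m (hp u v)

    H-elim : ∀ {u v} → H u v ≡ true → ∃[ t ] (t < m × ((y t ≡ u × y (suc t) ≡ v) ⊎ (y (suc t) ≡ u × y t ≡ v)))
    H-elim {u} {v} h with anyBelow-elim (hp u v) h
    ... | t , lt , q with ∨-elim {eqb (y t) u ∧ eqb (y (suc t)) v} q
    ... | inj₁ q1 = t , lt , inj₁ (eqb-true (∧-true₁ q1) , eqb-true (∧-true₂ q1))
    ... | inj₂ q2 = t , lt , inj₂ (eqb-true (∧-true₁ q2) , eqb-true (∧-true₂ q2))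

    H-forward : ∀ t → t < m → H (y t) (y (suc t)) ≡ true
    H-forward t lt = anyBelow-intro (hp (y t) (y (suc t))) t lt (∨-introl (∧-intro (eqb-refl (y t)) (eqb-refl (y (suc t)))))

    H-backward : ∀ t → t < m → H (y (suc t)) (y t) ≡ true
    H-backward t lt = anyBelow-intro (hp (y (suc t)) (y t)) t lt (∨-intror {eqb (y t) (y (suc t)) ∧ eqb (y (suc t)) (y t)} (∧-intro (eqb-refl (y (suc t))) (eqb-refl (y t))))

    H-sym : ∀ u v → H u v ≡ H v u
    H-sym u v = bool-ext (f u v) (f v u)
      where f : ∀ u v → H u v ≡ true → H v u ≡ true
            f u v h with H-elim h
            ... | t , lt , inj₁ (p , q) = subst₂ (λ a b → H a b ≡ true) q p (H-backward t lt)
            ... | t , lt , inj₂ (p , q) = subst₂ (λ a b → H a b ≡ true) q p (H-forward t lt)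

    sub : SubEdges G H
    sub = record { symH = H-sym ; subH = λ u v h → f h }
      where f : ∀ {u v} → H u v ≡ true → adj G u v ≡ true
            f h with H-elim h
            ... | t , lt , inj₁ (p , q) = subst₂ (λ a b → adj G a b ≡ true) p q (ad t lt)
            ... | t , lt , inj₂ (p , q) = subst₂ (λ a b → adj G a b ≡ true) p q (adj-symmetric (ad t lt))

    private
      lt0 : 0 < m
      lt0 = ≤-trans (s≤s z≤n) m≥3
      lt1 : 1 < m
      lt1 = ≤-trans (s≤s (s≤s z≤n)) m≥3

    predIndex : ℕ → ℕ
    predIndex zero = m ∸ 1
    predIndex (suc t) = t

    sm-1 : suc (m ∸ 1) ≡ m
    sm-1 = trans (+-comm 1 (m ∸ 1)) (m∸n+n≡m lt0)

    m-1<m : m ∸ 1 < m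
    m-1<m = subst (m ∸ 1 <_) sm-1 (n<1+n (m ∸ 1))

    H-predIndex : ∀ t → t < m → H (y t) (y (predIndex t)) ≡ true
    H-predIndex zero lt = subst (λ a → H a (y (m ∸ 1)) ≡ true) (trans (cong y sm-1) wrap) (H-backward (m ∸ 1) m-1<m)
    H-predIndex (suc t) lt = H-backward t (≤-trans (n≤1+n (suc t)) lt)

    neighbours : ∀ t → t < m → ∀ w → H (y t) w ≡ true → w ≡ y (suc t) ⊎ w ≡ y (predIndex t)
    neighbours t lt w h with H-elim h
    ... | s , ls , inj₁ (p , q) with D s t ls lt p
    ... | refl = inj₁ (sym q)
    neighbours t lt w h | s , ls , inj₂ (p , q) with m≤n⇒m<n∨m≡n ls
    ... | inj₁ sl with D (suc s) t sl lt p
    ... | refl = inj₂ (sym q)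
    neighbours t lt w h | s , ls , inj₂ (p , q) | inj₂ e with D 0 t lt0 lt (trans (sym wrap) (trans (cong y (sym e)) p))
    ... | refl = inj₂ (trans (sym q) (cong y (sym (trans (cong (_∸ 1) (sym e)) refl))))

    neighbours-distinct : ∀ t → t < m → ¬ y (suc t) ≡ y (predIndex t)
    neighbours-distinct zero lt e = <-irrefl refl (≤-trans m≥3 (≤-reflexive (trans (sym sm-1) (cong suc (sym (D 1 (m ∸ 1) lt1 m-1<m e))))))
    neighbours-distinct (suc t) lt e with m≤n⇒m<n∨m≡n lt
    ... | inj₁ sl = <-irrefl (sym (D (suc (suc t)) t sl (≤-trans (n≤1+n (suc t)) lt) e)) (≤-trans (n<1+n t) (n≤1+n _))
    ... | inj₂ eq with D 0 t lt0 (≤-trans (n≤1+n (suc t)) lt) (trans (sym wrap) (trans (cong y (sym eq)) e))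
    ... | refl = <-irrefl refl (≤-trans m≥3 (≤-reflexive (sym eq)))

    inImage : ∀ {v w} → H v w ≡ true → inRange y m v ≡ true
    inImage {v} h with H-elim h
    ... | t , lt , inj₁ (p , q) = subst (λ a → inRange y m a ≡ true) p (inRange-intro y t lt)
    ... | t , lt , inj₂ (p , q) with m≤n⇒m<n∨m≡n lt
    ... | inj₁ sl = subst (λ a → inRange y m a ≡ true) p (inRange-intro y (suc t) sl)
    ... | inj₂ e = subst (λ a → inRange y m a ≡ true) (trans (sym wrap) (trans (cong y (sym e)) p)) (inRange-intro y 0 lt0)

    deg-onSequence : ∀ t → t < m → deg H (y t) ≡ 2
    deg-onSequence t lt = trans (card-tab (H (y t))) (count-two (y (suc t)) (y (predIndex t)) (neighbours-distinct t lt) (H-forward t lt) (H-predIndex t lt) (neighbours t lt))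

    deg-offSequence : ∀ v → inRange y m v ≡ false → deg H v ≡ 0
    deg-offSequence v e = trans (card-tab (H v)) (count-zero {f = H v} (λ w → ¬-not (λ h → true≢false (trans (sym (inImage {v} {w} h)) e))))

    deg02 : ∀ v → deg H v ≡ 0 ⊎ deg H v ≡ 2
    deg02 v with inRange y m v in e
    ... | false = inj₁ (deg-offSequence v e)
    ... | true with inRange-elim y v e
    ... | t , lt , refl = inj₂ (deg-onSequence t lt)

    walk-++ : ∀ {E : Rel₂ n} {u v w} → Walk E u v → Walk E v w → Walk E u w
    walk-++ here q = q
    walk-++ (step e p) q = step e (walk-++ p q)

    walk-forward : ∀ i d → i + d ≤ m → Walk H (y i) (y (i + d))
    walk-forward i zero _ = subst (λ a → Walk H (y i) (y a)) (sym (+-identityʳ i)) here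
    walk-forward i (suc d) le = step (H-forward i (≤-trans (s≤s (m≤m+n i d)) (≤-trans (≤-reflexive (sym (+-suc i d))) le)))
      (subst (λ a → Walk H (y (suc i)) (y a)) (sym (+-suc i d)) (walk-forward (suc i) d (≤-trans (≤-reflexive (sym (+-suc i d))) le)))

    walk-between : ∀ i j → i < m → j < m → Walk H (y i) (y j)
    walk-between i j li lj with i ≤? j
    ... | yes le = subst (λ a → Walk H (y i) (y a)) (m+[n∸m]≡n le) (walk-forward i (j ∸ i) (≤-trans (≤-reflexive (m+[n∸m]≡n le)) (<⇒≤ lj)))
    ... | no _ = walk-++ (subst (λ a → Walk H (y i) a) (trans (cong y (m+[n∸m]≡n (<⇒≤ li))) wrap) (walk-forward i (m ∸ i) (≤-reflexive (m+[n∸m]≡n (<⇒≤ li)))))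
                      (walk-forward 0 j (<⇒≤ lj))

    conn : ∀ u v → ¬ (deg H u ≡ 0) → ¬ (deg H v ≡ 0) → Walk H u v
    conn u v du dv with inRange y m u in eu | inRange y m v in ev
    ... | false | _ = ⊥-elim (du (deg-offSequence u eu))
    ... | true | false = ⊥-elim (dv (deg-offSequence v ev))
    ... | true | true with inRange-elim y u eu | inRange-elim y v ev
    ... | i , li , refl | j , lj , refl = walk-between i j li lj

    isCycle : IsCycle G H
    isCycle = record { sub = sub ; nonempty = y 0 , y 1 , H-forward 0 lt0 ; deg02 = deg02 ; conn = conn }

  InMaximumIndependent : Fin n → Set
  InMaximumIndependent v = ∃[ S ] (MaximumIndependent G S × v ∈ S)

  Independentᵇ : (Fin n → Bool) → Set
  Independentᵇ S = ∀ u v → S u ≡ true → S v ≡ true → adj G u v ≡ false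

  independentᵇ-lookup : ∀ {T : Subset n} → Independent G T → Independentᵇ (lookup T)
  independentᵇ-lookup {T} I u v hu hv = I u v (vec-∈ hu) (vec-∈ hv)

  independent-tabulate : ∀ {S : Fin n → Bool} → Independentᵇ S → Independent G (tabulate S)
  independent-tabulate I u v hu hv = I u v (∈-tab hu) (∈-tab hv)

  maximumIndependent : (S : Fin n → Bool) → Independentᵇ S → (∀ T → Independentᵇ T → count T ≤ count S) → MaximumIndependent G (tabulate S)
  maximumIndependent S I B = independent-tabulate I , λ T IT → subst₂ _≤_ (sym (card-vec T)) (sym (card-tab S)) (B (lookup T) (independentᵇ-lookup IT))

  ¬maximum : ∀ {S : Subset n} → MaximumIndependent G S → (T : Fin n → Bool) → Independentᵇ T → suc (count (lookup S)) ≤ count T → ⊥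
  ¬maximum {S} (_ , M) T IT lt = <-irrefl refl (≤-<-trans (subst₂ _≤_ (card-tab T) (card-vec S) (M (tabulate T) (independent-tabulate IT))) lt)

  noImprovingSwap : ∀ {S : Subset n} → MaximumIndependent G S → (T : Fin n → Bool) → Independentᵇ T →
    (e : ℕ → Fin n) (m : ℕ) → Distinct e m → (∀ z → inRange e m z ≡ false → lookup S z ≡ T z) →
    suc (sumBelow m (λ t → bit (lookup S (e t)))) ≤ sumBelow m (λ t → bit (T (e t))) → ⊥
  noImprovingSwap {S} mx T IT e m D agree lt = ¬maximum mx T IT (+-cancelʳ-≤ ΣS (suc (count (lookup S))) (count T) stp)
    where
    ΣS ΣT : ℕ
    ΣS = sumBelow m (λ t → bit (lookup S (e t)))
    ΣT = sumBelow m (λ t → bit (T (e t)))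
    ex : count T + ΣS ≡ count (lookup S) + ΣT
    ex = exchange-count e m D (lookup S) T agree
    stp : suc (count (lookup S)) + ΣS ≤ count T + ΣS
    stp = ≤-trans (≤-reflexive (sym (+-suc (count (lookup S)) ΣS))) (≤-trans (+-monoʳ-≤ (count (lookup S)) lt) (≤-reflexive (sym ex)))

  independent-edge : ∀ {S : Fin n → Bool} → Independentᵇ S → ∀ {u v} → adj G u v ≡ true → S u ≡ true → S v ≡ false
  independent-edge I e su = ¬-not (λ sv → true≢false (trans (sym e) (I _ _ su sv)))

module CaterpillarWheelLemmas {n : ℕ} (G : Graph n) (C : Rel₂ n) (cw : CaterpillarWheel G C) where

  open GraphLemmas G
  open CaterpillarWheel cw

  C-sym : ∀ u v → C u v ≡ C v u
  C-sym = SubEdges.symH (IsCycle.sub cycle)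

  C⊆G : ∀ {u v} → C u v ≡ true → adj G u v ≡ true
  C⊆G {u} {v} = SubEdges.subH (IsCycle.sub cycle) u v

  C-symmetric : ∀ {u v} → C u v ≡ true → C v u ≡ true
  C-symmetric {u} {v} e = trans (C-sym v u) e

  cycle-deg≡2 : ∀ {u v} → C u v ≡ true → count (C u) ≡ 2
  cycle-deg≡2 {u} {v} e with IsCycle.deg02 cycle u
  ... | inj₁ d0 = ⊥-elim (true≢false (trans (sym e) (count-0→ (trans (sym (card-tab (C u))) d0) v)))
  ... | inj₂ d2 = trans (sym (card-tab (C u))) d2

  -- Walking around the cycle

  nextOnCycle : Fin n → Fin n → Fin n
  nextOnCycle c p with any? (λ w → (C c w BP.≟ true) ×-dec ¬? (w ≟ p))
  ... | yes (w , _) = w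
  ... | no _ = p

  nextOnCycle-spec : ∀ {c p} → C c p ≡ true → C c (nextOnCycle c p) ≡ true × ¬ nextOnCycle c p ≡ p
  nextOnCycle-spec {c} {p} e with any? (λ w → (C c w BP.≟ true) ×-dec ¬? (w ≟ p))
  ... | yes (w , q) = q
  ... | no nq = ⊥-elim (nq (let (b , nb , fb) = count≡2⇒other (cycle-deg≡2 e) e in b , fb , nb))

  leastWitness : ∀ (P : ℕ → Bool) m i → i ≤ m → P i ≡ true → ∃[ j ] (P j ≡ true × ∀ i → i < j → P i ≡ false)
  leastWitness P zero .zero z≤n h = 0 , h , λ i ()
  leastWitness P (suc m) i le h with anyBelow (suc m) P in e
  ... | true = let (i' , li' , pi') = anyBelow-elim P e in leastWitness P m i' (≤-pred li') pi'
  ... | false = i , h , λ i' lt → ¬-not (λ q → true≢false (trans (sym (anyBelow-intro P i' (≤-trans lt le) q)) e))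

  opaque
    firstRepetition : (x : ℕ → Fin n) → ∃[ k ] (anyBelow k (λ i → eqb (x i) (x k)) ≡ true × (∀ i → i < k → anyBelow i (λ i' → eqb (x i') (x i)) ≡ false))
    firstRepetition x with pigeonhole (n<1+n n) (λ (i : Fin (suc n)) → x (toℕ i))
    ... | i , j , lt , eq = leastWitness (λ j → anyBelow j (λ i → eqb (x i) (x j))) (toℕ j) (toℕ j) ≤-refl
            (anyBelow-intro (λ i' → eqb (x i') (x (toℕ j))) (toℕ i) lt (subst (λ a → eqb (x (toℕ i)) a ≡ true) eq (eqb-refl (x (toℕ i)))))

  record Enumeration (u0 v0 : Fin n) : Set where
    field
      k : ℕ
      x : ℕ → Fin n
      k≥3 : 3 ≤ k
      x0 : x 0 ≡ u0
      x1 : x 1 ≡ v0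
      per : ∀ t → x (t + k) ≡ x t
      D : Distinct x k
      edge : ∀ t → C (x t) (x (suc t)) ≡ true
      cedge : ∀ {u v} → C u v ≡ true → ∃[ t ] (t < k × ((x t ≡ u × x (suc t) ≡ v) ⊎ (x (suc t) ≡ u × x t ≡ v)))

  module CycleWalk (u0 v0 : Fin n) (e0 : C u0 v0 ≡ true) where

    steps : ℕ → Fin n × Fin n
    steps zero = u0 , v0
    steps (suc t) = proj₂ (steps t) , nextOnCycle (proj₂ (steps t)) (proj₁ (steps t))
    x : ℕ → Fin n
    x t = proj₁ (steps t)
    walk-edge : ∀ t → C (x t) (x (suc t)) ≡ true
    walk-edge zero = e0
    walk-edge (suc t) = proj₁ (nextOnCycle-spec (C-symmetric (walk-edge t)))
    noBacktrack : ∀ t → ¬ x (suc (suc t)) ≡ x t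
    noBacktrack t = proj₂ (nextOnCycle-spec (C-symmetric (walk-edge t)))
    noLoop : ∀ t → ¬ x t ≡ x (suc t)
    noLoop t = adj⇒≢ (C⊆G (walk-edge t))
    seenBefore : ℕ → Bool
    seenBefore j = anyBelow j (λ i → eqb (x i) (x j))
    firstRepeat : ∃[ k ] (seenBefore k ≡ true × (∀ i → i < k → seenBefore i ≡ false))
    firstRepeat = firstRepetition x
    k : ℕ
    k = proj₁ firstRepeat
    seenBefore-k : seenBefore k ≡ true
    seenBefore-k = proj₁ (proj₂ firstRepeat)
    unseenBefore : ∀ i → i < k → seenBefore i ≡ false
    unseenBefore = proj₂ (proj₂ firstRepeat)
    distinct : Distinct x k
    distinct a b la lb e with <-cmp a b
    ... | tri≈ _ p _ = p
    ... | tri< lt _ _ = ⊥-elim (true≢false (trans (sym (anyBelow-intro (λ i → eqb (x i) (x b)) a lt (subst (λ z → eqb z (x b) ≡ true) (sym e) (eqb-refl (x b))))) (unseenBefore b lb)))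
    ... | tri> _ _ gt = ⊥-elim (true≢false (trans (sym (anyBelow-intro (λ i → eqb (x i) (x a)) b gt (subst (λ z → eqb z (x a) ≡ true) e (eqb-refl (x a))))) (unseenBefore a la)))
    earlierCopy : ∃[ i ] (i < k × eqb (x i) (x k) ≡ true)
    earlierCopy = anyBelow-elim (λ i → eqb (x i) (x k)) seenBefore-k
    -- A repeat of some x (suc i) would give that vertex a third neighbour on C.
    earlierCopy≡0 : proj₁ earlierCopy ≡ 0
    earlierCopy≡0 = go (proj₁ earlierCopy) (proj₁ (proj₂ earlierCopy)) (eqb-true (proj₂ (proj₂ earlierCopy)))
      where
      go : ∀ i → i < k → x i ≡ x k → i ≡ 0
      go zero _ _ = refl
      go (suc i') lt eq with m≤n⇒m<n∨m≡n lt
      ... | inj₂ e = ⊥-elim (noLoop (suc i') (trans eq (cong x (sym e))))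
      ... | inj₁ slt = ⊥-elim (finish k refl)
        where
        finish : ∀ k' → k' ≡ k → ⊥
        finish zero e = <-irrefl refl (≤-trans (s≤s z≤n) (subst (suc i' <_) (sym e) lt))
        finish (suc k') e with count≡2⇒third (cycle-deg≡2 (walk-edge (suc i'))) {x (suc (suc i'))} {x i'} {x k'} (walk-edge (suc i')) (C-symmetric (walk-edge i'))
                     (λ q → <-irrefl (sym (distinct (suc (suc i')) i' slt (≤-trans (n≤1+n _) (≤-trans (n≤1+n _) slt)) q)) (≤-trans (n<1+n i') (n≤1+n _)))
                     (trans (cong (λ z → C z (x k')) eq) (trans (cong (λ z → C (x z) (x k')) (sym e)) (C-symmetric (walk-edge k'))))
        ... | inj₁ q with distinct k' (suc (suc i')) (subst (k' <_) e (n<1+n k')) slt q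
        ... | refl = noBacktrack (suc i') (trans (cong x e) (sym eq))
        finish (suc k') e | inj₂ q with distinct k' i' (subst (k' <_) e (n<1+n k')) (≤-trans (n≤1+n _) (≤-trans (n≤1+n _) slt)) q
        ... | refl = <-irrefl e lt
    returns : x k ≡ x 0
    returns = trans (sym (eqb-true (proj₂ (proj₂ earlierCopy)))) (cong x earlierCopy≡0)
    k≥3 : 3 ≤ k
    k≥3 = go k refl
      where
      go : ∀ k' → k' ≡ k → 3 ≤ k'
      go zero e = ⊥-elim (n≮0 (subst (proj₁ earlierCopy <_) (sym e) (proj₁ (proj₂ earlierCopy))))
      go (suc zero) e = ⊥-elim (noLoop 0 (sym (trans (cong x e) returns)))
      go (suc (suc zero)) e = ⊥-elim (noBacktrack 0 (trans (cong x e) returns))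
      go (suc (suc (suc k'))) e = s≤s (s≤s (s≤s z≤n))
    k' : ℕ
    k' = k ∸ 1
    sk' : suc k' ≡ k
    sk' = trans (+-comm 1 k') (m∸n+n≡m {k} {1} (≤-trans (s≤s z≤n) k≥3))
    returns₁ : x (suc k) ≡ x 1
    returns₁ with count≡2⇒third (cycle-deg≡2 (walk-edge 0)) {x 1} {x k'} {x (suc k)} (walk-edge 0)
                (subst (λ z → C z (x k') ≡ true) returns (subst (λ j → C (x j) (x k') ≡ true) sk' (C-symmetric (walk-edge k'))))
                (λ q → <-irrefl (trans (cong suc ((distinct 1 k' (≤-trans (s≤s (s≤s z≤n)) k≥3) (subst (k' <_) sk' (n<1+n k')) q))) sk') (≤-trans (s≤s (s≤s (s≤s z≤n))) k≥3))
                (subst (λ z → C z (x (suc k)) ≡ true) returns (walk-edge k))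
    ... | inj₁ q = q
    ... | inj₂ q = ⊥-elim (noBacktrack k' (trans (cong (λ j → x (suc j)) sk') q))
    periodic : ∀ t → x (t + k) ≡ x t × x (suc t + k) ≡ x (suc t)
    periodic zero = returns , returns₁
    periodic (suc t) = proj₂ (periodic t) , cong₂ nextOnCycle (proj₂ (periodic t)) (proj₁ (periodic t))
    walk-adj : ∀ t → t < k → adj G (x t) (x (suc t)) ≡ true
    walk-adj t _ = C⊆G (walk-edge t)
    module S = CycleOfSequence x k k≥3 distinct returns walk-adj
    H≡C : ∀ u v → S.H u v ≡ C u v
    H≡C = unique S.H S.isCycle
    C-edge : ∀ {u v} → C u v ≡ true → ∃[ t ] (t < k × ((x t ≡ u × x (suc t) ≡ v) ⊎ (x (suc t) ≡ u × x t ≡ v)))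
    C-edge {u} {v} h = S.H-elim (trans (H≡C u v) h)

  enumerate′ : ∀ u0 v0 → C u0 v0 ≡ true → Enumeration u0 v0
  enumerate′ u0 v0 e0 = record
    { k = k ; x = x ; k≥3 = k≥3 ; x0 = refl ; x1 = refl ; per = λ t → proj₁ (periodic t) ; D = distinct
    ; edge = walk-edge ; cedge = C-edge }
    where open CycleWalk u0 v0 e0

  opaque
    enumerate : ∀ u0 v0 → C u0 v0 ≡ true → Enumeration u0 v0
    enumerate = enumerate′

  module EnumerationLemmas {u0 v0 : Fin n} (E : Enumeration u0 v0) where
    open Enumeration E public

    lt0 : 0 < k
    lt0 = ≤-trans (s≤s z≤n) k≥3

    k' : ℕ
    k' = k ∸ 1

    sk' : suc k' ≡ k
    sk' = trans (+-comm 1 k') (m∸n+n≡m {k} {1} lt0)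

    k'<k : k' < k
    k'<k = subst (k' <_) sk' (n<1+n k')

    xk : x k ≡ x 0
    xk = per 0

    distinct-shifted : ∀ i a b → a < k → b < k → x (i + a) ≡ x (i + b) → a ≡ b
    distinct-shifted zero a b la lb e = D a b la lb e
    distinct-shifted (suc i) a b la lb e with m≤n⇒m<n∨m≡n la | m≤n⇒m<n∨m≡n lb
    ... | inj₁ sa | inj₁ sb = suc-injective (distinct-shifted i (suc a) (suc b) sa sb (trans (cong x (+-suc i a)) (trans e (cong x (sym (+-suc i b))))))
    ... | inj₂ ea | inj₂ eb = suc-injective (trans ea (sym eb))
    ... | inj₂ ea | inj₁ sb = ⊥-elim (0≢1+n (distinct-shifted i 0 (suc b) lt0 sb (trans (cong x (+-identityʳ i)) (trans (sym (per i)) (trans (cong (λ j → x (i + j)) (sym ea)) (trans (cong x (+-suc i a)) (trans e (cong x (sym (+-suc i b))))))))))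
    ... | inj₁ sa | inj₂ eb = ⊥-elim (0≢1+n (distinct-shifted i 0 (suc a) lt0 sa (trans (cong x (+-identityʳ i)) (trans (sym (per i)) (trans (cong (λ j → x (i + j)) (sym eb)) (trans (cong x (+-suc i b)) (trans (sym e) (cong x (sym (+-suc i a))))))))))

    reduceIndex : ∀ t → ∃[ r ] (r < k × ∀ s → x (s + t) ≡ x (s + r))
    reduceIndex zero = 0 , lt0 , λ s → refl
    reduceIndex (suc t) with reduceIndex t
    ... | r , lr , h with m≤n⇒m<n∨m≡n lr
    ... | inj₁ sr = suc r , sr , λ s → trans (cong x (+-suc s t)) (trans (h (suc s)) (cong x (sym (+-suc s r))))
    ... | inj₂ er = 0 , lt0 , λ s → trans (cong x (+-suc s t)) (trans (h (suc s)) (trans (cong x (sym (+-suc s r))) (trans (cong (λ j → x (s + j)) er) (trans (per s) (cong x (sym (+-identityʳ s)))))))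

    x-cong-shift : ∀ {i j} → x i ≡ x j → ∀ s → x (s + i) ≡ x (s + j)
    x-cong-shift {i} {j} e s with reduceIndex i | reduceIndex j
    ... | ri , li , hi | rj , lj , hj with D ri rj li lj (trans (sym (hi 0)) (trans e (hj 0)))
    ... | refl = trans (hi s) (sym (hj s))

    x-suc-cong : ∀ {i j} → x i ≡ x j → x (suc i) ≡ x (suc j)
    x-suc-cong e = x-cong-shift e 1

    x-suc-injective : ∀ {a b} → x (suc a) ≡ x (suc b) → x a ≡ x b
    x-suc-injective {a} {b} e with reduceIndex a | reduceIndex b
    ... | ra , la , ha | rb , lb , hb = trans (ha 0) (trans (cong x (go (m≤n⇒m<n∨m≡n la) (m≤n⇒m<n∨m≡n lb))) (sym (hb 0)))
      where
      e' : x (suc ra) ≡ x (suc rb)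
      e' = trans (sym (ha 1)) (trans e (hb 1))
      go : suc ra < k ⊎ suc ra ≡ k → suc rb < k ⊎ suc rb ≡ k → ra ≡ rb
      go (inj₁ sa) (inj₁ sb) = suc-injective (D _ _ sa sb e')
      go (inj₂ ea) (inj₂ eb) = suc-injective (trans ea (sym eb))
      go (inj₂ ea) (inj₁ sb) = ⊥-elim (0≢1+n (D 0 (suc rb) lt0 sb (trans (sym xk) (trans (cong x (sym ea)) e'))))
      go (inj₁ sa) (inj₂ eb) = ⊥-elim (0≢1+n (D 0 (suc ra) lt0 sa (trans (sym xk) (trans (cong x (sym eb)) (sym e')))))

    C-neighbours : ∀ i w → C (x (suc i)) w ≡ true → w ≡ x (suc (suc i)) ⊎ w ≡ x i
    C-neighbours i w h with cedge h
    ... | t , lt , inj₁ (p , q) = inj₁ (trans (sym q) (x-suc-cong p))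
    ... | t , lt , inj₂ (p , q) = inj₂ (trans (sym q) (x-suc-injective p))

    indexOf : ∀ z → OnCycle C z → ∃[ t ] (t < k × x t ≡ z)
    indexOf z (w , h) with cedge h
    ... | t , lt , inj₁ (p , _) = t , lt , p
    ... | t , lt , inj₂ (p , _) with m≤n⇒m<n∨m≡n lt
    ... | inj₁ st = suc t , st , p
    ... | inj₂ et = 0 , lt0 , trans (sym xk) (trans (cong x (sym et)) p)

    reachAfterShift : ∀ s t → ∃[ r ] (r < k × x (s + r) ≡ x t)
    reachAfterShift zero t = let (r , lr , h) = reduceIndex t in r , lr , sym (h 0)
    reachAfterShift (suc s) t with reachAfterShift s t
    ... | zero , lr , h = k' , k'<k , trans (cong x (trans (sym (+-suc s k')) (cong (s +_) sk'))) (trans (per s) (trans (cong x (sym (+-identityʳ s))) h))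
    ... | suc r , lr , h = r , ≤-trans (n≤1+n (suc r)) lr , trans (cong x (sym (+-suc s r))) h

    shift : ∀ s → Enumeration (x s) (x (suc s))
    shift s = record
      { k = k ; x = λ t → x (s + t) ; k≥3 = k≥3 ; x0 = cong x (+-identityʳ s) ; x1 = cong x (trans (+-suc s 0) (cong suc (+-identityʳ s)))
      ; per = λ t → trans (cong x (sym (+-assoc s t k))) (per (s + t))
      ; D = distinct-shifted s
      ; edge = λ t → subst (λ j → C (x (s + t)) (x j) ≡ true) (sym (+-suc s t)) (edge (s + t))
      ; cedge = ce }
      where
      ce : ∀ {u v} → C u v ≡ true → ∃[ t ] (t < k × ((x (s + t) ≡ u × x (s + suc t) ≡ v) ⊎ (x (s + suc t) ≡ u × x (s + t) ≡ v)))
      ce h with cedge h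
      ... | t , lt , inj₁ (p , q) = let (r , lr , hr) = reachAfterShift s t in r , lr , inj₁ (trans hr p , trans (cong x (+-suc s r)) (trans (x-suc-cong hr) q))
      ... | t , lt , inj₂ (p , q) = let (r , lr , hr) = reachAfterShift s t in r , lr , inj₂ (trans (cong x (+-suc s r)) (trans (x-suc-cong hr) p) , trans hr q)

  onCycle? : ∀ z → Dec (OnCycle C z)
  onCycle? z = any? (λ w → C z w BP.≟ true)

  onCycleᵇ : Fin n → Bool
  onCycleᵇ z = does (onCycle? z)

  onCycleᵇ-true : ∀ {z} → onCycleᵇ z ≡ true → OnCycle C z
  onCycleᵇ-true {z} e with onCycle? z
  ... | yes p = p

  onCycleᵇ-false : ∀ {z} → onCycleᵇ z ≡ false → ¬ OnCycle C z
  onCycleᵇ-false {z} e with onCycle? z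
  ... | no p = p

  onCycle⇒onCycleᵇ : ∀ {z} → OnCycle C z → onCycleᵇ z ≡ true
  onCycle⇒onCycleᵇ {z} o with onCycle? z
  ... | yes _ = refl
  ... | no p = ⊥-elim (p o)

  offCycle⇒onCycleᵇ-false : ∀ {z} → ¬ OnCycle C z → onCycleᵇ z ≡ false
  offCycle⇒onCycleᵇ-false {z} o with onCycle? z
  ... | yes p = ⊥-elim (o p)
  ... | no _ = refl

  onCycle-enumerated : ∀ {u0 v0} (E : Enumeration u0 v0) t → OnCycle C (Enumeration.x E t)
  onCycle-enumerated E t = Enumeration.x E (suc t) , Enumeration.edge E t

  enumerationFrom : ∀ z → OnCycle C z → Σ[ w ∈ Fin n ] Enumeration z w
  enumerationFrom z (w , h) = w , enumerate z w h

  offCycle-neighbourOnCycle : ∀ {w a} → ¬ OnCycle C w → adj G w a ≡ true → OnCycle C a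
  offCycle-neighbourOnCycle {w} {a} nw h with edgeOnC w a h
  ... | inj₁ p = ⊥-elim (nw p)
  ... | inj₂ p = p

  if≤ : ℕ → ℕ → {A : Set} → A → A → A
  if≤ s j a b with s ≤? j
  ... | yes _ = a
  ... | no _ = b

  if≤-yes : ∀ {s j} {A : Set} {a b : A} → s ≤ j → if≤ s j a b ≡ a
  if≤-yes {s} {j} le with s ≤? j
  ... | yes _ = refl
  ... | no p = ⊥-elim (p le)

  if≤-no : ∀ {s j} {A : Set} {a b : A} → ¬ s ≤ j → if≤ s j a b ≡ b
  if≤-no {s} {j} nle with s ≤? j
  ... | yes p = ⊥-elim (nle p)
  ... | no _ = refl

  -- Vertices off C are leaves and C has no chords

  -- w, x 0, …, x j, w would be a second cycle, through the off-cycle vertex w.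
  module TwoNeighboursOffCycle {w a b c0 : Fin n} (nw : ¬ OnCycle C w) (ha : adj G w a ≡ true) (hb : adj G w b ≡ true)
              (E : Enumeration a c0) (j : ℕ) (lj : j < Enumeration.k E) (xj : Enumeration.x E j ≡ b) (j≥1 : 1 ≤ j) where
    open EnumerationLemmas E
    y : ℕ → Fin n
    y zero = w
    y (suc s) = if≤ s j (x s) w
    m : ℕ
    m = suc (suc j)
    m≥3 : 3 ≤ m
    m≥3 = s≤s (s≤s j≥1)
    ysuc : ∀ s → s ≤ j → y (suc s) ≡ x s
    ysuc s le = if≤-yes le
    wnx : ∀ s → ¬ w ≡ x s
    wnx s e = nw (subst (OnCycle C) (sym e) (onCycle-enumerated E s))
    Dy : Distinct y m
    Dy zero zero _ _ _ = refl
    Dy zero (suc s) _ ls e = ⊥-elim (wnx s (trans e (ysuc s (≤-pred (≤-pred ls)))))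
    Dy (suc s) zero ls _ e = ⊥-elim (wnx s (sym (trans (sym (ysuc s (≤-pred (≤-pred ls)))) e)))
    Dy (suc s) (suc t) ls lt e = cong suc (D s t (≤-<-trans (≤-pred (≤-pred ls)) lj) (≤-<-trans (≤-pred (≤-pred lt)) lj)
                                      (trans (sym (ysuc s (≤-pred (≤-pred ls)))) (trans e (ysuc t (≤-pred (≤-pred lt))))))
    wrap : y m ≡ y 0
    wrap = if≤-no {suc j} {j} (λ q → <-irrefl refl q)
    ad : ∀ t → t < m → adj G (y t) (y (suc t)) ≡ true
    ad zero _ = trans (cong (adj G w) (trans (ysuc 0 z≤n) x0)) ha
    ad (suc s) lt with m≤n⇒m<n∨m≡n (≤-pred lt)
    ... | inj₁ sl = subst₂ (λ p q → adj G p q ≡ true) (sym (ysuc s (<⇒≤ (≤-pred sl)))) (sym (ysuc (suc s) (≤-pred sl))) (C⊆G (edge s))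
    ... | inj₂ e = subst₂ (λ p q → adj G p q ≡ true) (sym (ysuc s (≤-reflexive (suc-injective e)))) (sym (if≤-no (λ q → <-irrefl (suc-injective e) q)))
                     (trans (cong (λ z → adj G z w) (trans (cong x (suc-injective e)) xj)) (adj-symmetric hb))
    module S = CycleOfSequence y m m≥3 Dy wrap ad
    same : SameEdges S.H C
    same = unique S.H S.isCycle
    absurd : ⊥
    absurd = nw (y 1 , trans (sym (same w (y 1))) (S.H-forward 0 (≤-trans (s≤s z≤n) m≥3)))

  offCycle-uniqueNeighbour : ∀ {w a b} → ¬ OnCycle C w → adj G w a ≡ true → adj G w b ≡ true → a ≡ b
  offCycle-uniqueNeighbour {w} {a} {b} nw ha hb with a ≟ b
  ... | yes p = p
  ... | no ab with enumerationFrom a (offCycle-neighbourOnCycle nw ha)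
  ... | c0 , E with EnumerationLemmas.indexOf E b (offCycle-neighbourOnCycle nw hb)
  ... | zero , lj , xj = ⊥-elim (ab (trans (sym (Enumeration.x0 E)) xj))
  ... | suc j , lj , xj = ⊥-elim (TwoNeighboursOffCycle.absurd nw ha hb E (suc j) lj xj (s≤s z≤n))

  -- x 0, …, x j closed by the edge b a is a cycle, hence it is C.
  module ChordCycle {a b c0 : Fin n} (h : adj G a b ≡ true)
              (E : Enumeration a c0) (j : ℕ) (lj : j < Enumeration.k E) (xj : Enumeration.x E j ≡ b) (j≥2 : 2 ≤ j) where
    open EnumerationLemmas E
    y : ℕ → Fin n
    y s = if≤ s j (x s) (x 0)
    m : ℕ
    m = suc j
    m≥3 : 3 ≤ m
    m≥3 = s≤s j≥2
    yle : ∀ s → s ≤ j → y s ≡ x s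
    yle s le = if≤-yes le
    ysj : y j ≡ x j
    ysj = yle j ≤-refl
    y0 : y (suc j) ≡ a
    y0 = trans (if≤-no {suc j} {j} (λ q → <-irrefl refl q)) x0
    Dy : Distinct y m
    Dy s t ls lt e = D s t (≤-<-trans (≤-pred ls) lj) (≤-<-trans (≤-pred lt) lj) (trans (sym (yle s (≤-pred ls))) (trans e (yle t (≤-pred lt))))
    wrap : y m ≡ y 0
    wrap = trans y0 (trans (sym x0) (sym (yle 0 z≤n)))
    ad : ∀ t → t < m → adj G (y t) (y (suc t)) ≡ true
    ad t lt with m≤n⇒m<n∨m≡n (≤-pred lt)
    ... | inj₁ sl = subst₂ (λ p q → adj G p q ≡ true) (sym (yle t (<⇒≤ sl))) (sym (yle (suc t) sl)) (C⊆G (edge t))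
    ... | inj₂ refl = subst₂ (λ p q → adj G p q ≡ true) (sym (trans ysj xj)) (sym y0) (adj-symmetric h)
    module S = CycleOfSequence y m m≥3 Dy wrap ad
    same : SameEdges S.H C
    same = unique S.H S.isCycle
    chord∈C : C a b ≡ true
    chord∈C = C-symmetric (trans (sym (same b a)) (subst₂ (λ p q → S.H p q ≡ true) (trans ysj xj) y0 (S.H-forward j (n<1+n j))))

  adj⇒cycleEdge : ∀ {a b} → OnCycle C a → OnCycle C b → adj G a b ≡ true → C a b ≡ true
  adj⇒cycleEdge {a} {b} oa ob h with enumerationFrom a oa
  ... | c0 , E with EnumerationLemmas.indexOf E b ob
  ... | zero , lj , xj = ⊥-elim (adj⇒≢ h (trans (sym (Enumeration.x0 E)) xj))
  ... | suc zero , lj , xj = subst₂ (λ p q → C p q ≡ true) (Enumeration.x0 E) xj (Enumeration.edge E 0)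
  ... | suc (suc j) , lj , xj = ChordCycle.chord∈C h E (suc (suc j)) lj xj (s≤s (s≤s z≤n))

  someOnCycle : ∃[ u ] OnCycle C u
  someOnCycle = let (u , v , h) = IsCycle.nonempty cycle in u , v , h

  offCycle-hasNeighbour : ∀ {w} → ¬ OnCycle C w → ∃[ c ] adj G w c ≡ true
  offCycle-hasNeighbour {w} nw = go (connected w (proj₁ someOnCycle)) (proj₂ someOnCycle)
    where
    go : ∀ {u} → Walk (adj G) w u → OnCycle C u → ∃[ c ] adj G w c ≡ true
    go here ou = ⊥-elim (nw ou)
    go (step {v = v} e _) _ = v , e

  offCycle⇒deg≡1 : ∀ {w} → ¬ OnCycle C w → deg (adj G) w ≡ 1
  offCycle⇒deg≡1 {w} nw = let (c , h) = offCycle-hasNeighbour nw in trans (card-tab (adj G w)) (count-one c h (λ z hz → offCycle-uniqueNeighbour nw hz h))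

  onCycle⇒deg≢1 : ∀ {c} → OnCycle C c → ¬ deg (adj G) c ≡ 1
  onCycle⇒deg≢1 {c} (w , h) d1 = let (b , nb , hb) = count≡2⇒other {f = C c} (cycle-deg≡2 h) h in
    nb (count≡1⇒unique {f = adj G c} (trans (sym (card-tab (adj G c))) d1) (C⊆G hb) (C⊆G h))

  deg≡1⇒offCycle : ∀ {u} → deg (adj G) u ≡ 1 → ¬ OnCycle C u
  deg≡1⇒offCycle d o = onCycle⇒deg≢1 o d

  -- Graphs without legs

  noLeg⇒onCycle : NoLeg G → ∀ z → OnCycle C z
  noLeg⇒onCycle nl z with onCycle? z
  ... | yes p = p
  ... | no p = let (c , h) = offCycle-hasNeighbour p in ⊥-elim (nl z c (h , inj₁ (offCycle⇒deg≡1 p)))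

  module OddPositions (nl : NoLeg G) {w v : Fin n} (E : Enumeration w v) where
    open EnumerationLemmas E
    S : Fin n → Bool
    S z = anyBelow k (λ t → odd t ∧ eqb (x t) z)
    v∈S : S v ≡ true
    v∈S = anyBelow-intro (λ t → odd t ∧ eqb (x t) v) 1 (≤-trans (s≤s (s≤s z≤n)) k≥3) (∧-intro refl (trans (cong (λ q → eqb q v) x1) (eqb-refl v)))
    S-at : ∀ t → t < k → S (x t) ≡ odd t
    S-at t lt = bool-ext f (λ o → anyBelow-intro (λ s → odd s ∧ eqb (x s) (x t)) t lt (∧-intro o (eqb-refl (x t))))
      where f : S (x t) ≡ true → odd t ≡ true
            f h = let (s , ls , q) = anyBelow-elim (λ s → odd s ∧ eqb (x s) (x t)) h in
                  subst (λ j → odd j ≡ true) (D s t ls lt (eqb-true (∧-true₂ q))) (∧-true₁ q)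
    S-elim : ∀ {z} → S z ≡ true → ∃[ t ] (t < k × x t ≡ z × odd t ≡ true)
    S-elim h = let (s , ls , q) = anyBelow-elim _ h in s , ls , eqb-true (∧-true₂ q) , ∧-true₁ q
    oddIndices-nonconsecutive : ∀ a b → a < k → b < k → odd a ≡ true → odd b ≡ true → x (suc a) ≡ x b → ⊥
    oddIndices-nonconsecutive a b la lb oa ob e with m≤n⇒m<n∨m≡n la
    ... | inj₁ sa with D (suc a) b sa lb e
    ... | refl = true≢false (trans (sym ob) (cong not oa))
    oddIndices-nonconsecutive a b la lb oa ob e | inj₂ ea with D 0 b lt0 lb (trans (sym xk) (trans (cong x (sym ea)) e))
    ... | refl = true≢false (sym ob)
    independent : Independentᵇ S
    independent u z hu hz = ¬-not λ h → go (cedge (adj⇒cycleEdge (noLeg⇒onCycle nl u) (noLeg⇒onCycle nl z) h))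
      where
      go : ∃[ t ] (t < k × ((x t ≡ u × x (suc t) ≡ z) ⊎ (x (suc t) ≡ u × x t ≡ z))) → ⊥
      go (t , lt , inj₁ (p , q)) = let (a , la , xa , oa) = S-elim hu ; (b , lb , xb , ob) = S-elim hz in
        oddIndices-nonconsecutive a b la lb oa ob (trans (x-suc-cong (trans xa (sym p))) (trans q (sym xb)))
      go (t , lt , inj₂ (p , q)) = let (a , la , xa , oa) = S-elim hz ; (b , lb , xb , ob) = S-elim hu in
        oddIndices-nonconsecutive a b la lb oa ob (trans (x-suc-cong (trans xa (sym q))) (trans p (sym xb)))
    count-S : count S ≡ ⌊ k /2⌋
    count-S = trans (count≡sum x k D S (λ z h → let (t , lt , xt , _) = S-elim h in subst (λ q → inRange x k q ≡ true) xt (inRange-intro x t lt)))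
           (trans (sumBelow-ext k (λ t lt → cong bit (S-at t lt))) (sumBelow-odd k))
    -- Summing T (x t) + T (x (t + 1)) ≤ 1 over the k edges of C counts every vertex twice.
    independent≤S : ∀ T → Independentᵇ T → count T ≤ count S
    independent≤S T IT = subst (count T ≤_) (sym count-S) (m+m≤n⇒m≤⌊n/2⌋ (count T) k (subst (λ q → q + q ≤ k) (sym cT) two))
      where
      g : ℕ → ℕ
      g t = bit (T (x t))
      cT : count T ≡ sumBelow k g
      cT = count≡sum x k D T (λ z _ → let (t , lt , xt) = indexOf z (noLeg⇒onCycle nl z) in subst (λ q → inRange x k q ≡ true) xt (inRange-intro x t lt))
      pair : ∀ t → g t + g (suc t) ≤ 1
      pair t with T (x t) in e1 | T (x (suc t)) in e2
      ... | false | _ = bit≤1 _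
      ... | true | false = ≤-refl
      ... | true | true = ⊥-elim (true≢false (trans (sym (C⊆G (edge t))) (IT _ _ e1 e2)))
      two : sumBelow k g + sumBelow k g ≤ k
      two = subst (_≤ k) (trans (sumBelow-+ k g (λ t → g (suc t))) (cong (sumBelow k g +_) (sumBelow-rotate k g (cong (λ q → bit (T q)) xk))))
              (sumBelow-≤ k _ (λ t _ → pair t))

  noLeg⇒alphaExcellent : NoLeg G → AlphaExcellent G
  noLeg⇒alphaExcellent nl v = tabulate S , maximumIndependent S independent independent≤S , tab-∈ v∈S
    where
    open OddPositions nl (enumerate (proj₁ (noLeg⇒onCycle nl v)) v (C-symmetric (proj₂ (noLeg⇒onCycle nl v))))

  -- A perfect matching and two legs make G α-excellent

  leg-offCycleEnd : ∀ {a b} → IsLeg G a b → (¬ OnCycle C a × OnCycle C b) ⊎ (¬ OnCycle C b × OnCycle C a)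
  leg-offCycleEnd {a} {b} (h , inj₁ d) = inj₁ (deg≡1⇒offCycle d , offCycle-neighbourOnCycle (deg≡1⇒offCycle d) h)
  leg-offCycleEnd {a} {b} (h , inj₂ d) = inj₂ (deg≡1⇒offCycle d , offCycle-neighbourOnCycle (deg≡1⇒offCycle d) (adj-symmetric h))

  twoLegs⇒twoLeaves : AtLeastTwoLegs G → ∃[ l1 ] ∃[ l2 ] (¬ OnCycle C l1 × ¬ OnCycle C l2 × ¬ l1 ≡ l2)
  twoLegs⇒twoLeaves (u , w , u' , w' , L1 , L2 , n1 , n2) with leg-offCycleEnd L1 | leg-offCycleEnd L2
  ... | inj₁ (ou , _) | inj₁ (ou' , _) = u , u' , ou , ou' , λ e → n1 (e , offCycle-uniqueNeighbour ou (proj₁ L1) (subst (λ q → adj G q w' ≡ true) (sym e) (proj₁ L2)))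
  ... | inj₁ (ou , _) | inj₂ (ow' , _) = u , w' , ou , ow' , λ e → n2 (e , offCycle-uniqueNeighbour ou (proj₁ L1) (subst (λ q → adj G q u' ≡ true) (sym e) (adj-symmetric (proj₁ L2))))
  ... | inj₂ (ow , _) | inj₁ (ou' , _) = w , u' , ow , ou' , λ e → n2 (offCycle-uniqueNeighbour ow (adj-symmetric (proj₁ L1)) (subst (λ q → adj G q w' ≡ true) (sym e) (proj₁ L2)) , e)
  ... | inj₂ (ow , _) | inj₂ (ow' , _) = w , w' , ow , ow' , λ e → n1 (offCycle-uniqueNeighbour ow (adj-symmetric (proj₁ L1)) (subst (λ q → adj G q u' ≡ true) (sym e) (adj-symmetric (proj₁ L2))) , e)

  module PerfectMatching (M : Rel₂ n) (sM : SubEdges G M) (dM : ∀ v → deg M v ≡ 1) where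

    count-M : ∀ v → count (M v) ≡ 1
    count-M v = trans (sym (card-tab (M v))) (dM v)

    opaque
      partner : Fin n → Fin n
      partner v = proj₁ (count-exists (M v) (≤-reflexive (sym (count-M v))))

      partner-M : ∀ v → M v (partner v) ≡ true
      partner-M v = proj₂ (count-exists (M v) (≤-reflexive (sym (count-M v))))

    partner-unique : ∀ {v w} → M v w ≡ true → w ≡ partner v
    partner-unique {v} h = count≡1⇒unique (count-M v) h (partner-M v)

    partner-involutive : ∀ v → partner (partner v) ≡ v
    partner-involutive v = sym (partner-unique (trans (SubEdges.symH sM (partner v) v) (partner-M v)))

    partner-adj : ∀ v → adj G v (partner v) ≡ true
    partner-adj v = SubEdges.subH sM v (partner v) (partner-M v)

    partner-injective : ∀ {a b} → partner a ≡ partner b → a ≡ b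
    partner-injective {a} {b} e = trans (sym (partner-involutive a)) (trans (cong partner e) (partner-involutive b))

    partner-ofLeaf : ∀ {l} → ¬ OnCycle C l → ∀ {c} → adj G l c ≡ true → partner l ≡ c
    partner-ofLeaf nl h = offCycle-uniqueNeighbour nl (partner-adj _) h

    -- T and its image under the partner involution are disjoint.
    independent-twice≤ : ∀ T → Independentᵇ T → count T + count T ≤ n
    independent-twice≤ T IT = subst (λ q → count T + q ≤ n) (count-involution partner partner-involutive T) (count-disj T (λ z → T (partner z)) (λ z h → independent-edge IT (partner-adj z) h))

    complementary⇒maximum : (S : Fin n → Bool) → Independentᵇ S → (∀ z → S (partner z) ≡ not (S z)) → MaximumIndependent G (tabulate S)
    complementary⇒maximum S IS S-complementary = maximumIndependent S IS λ T IT → m+m≤n+n⇒m≤n (≤-trans (independent-twice≤ T IT) (≤-reflexive (sym eqn)))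
      where
      eqn : count S + count S ≡ n
      eqn = trans (cong (count S +_) (trans (sym (count-involution partner partner-involutive S)) (count-ext S-complementary))) (count-not S)
      m+m≤n+n⇒m≤n : ∀ {a b} → a + a ≤ b + b → a ≤ b
      m+m≤n+n⇒m≤n {a} {b} h with a ≤? b
      ... | yes q = q
      ... | no q = ⊥-elim (<-irrefl refl (≤-<-trans h (+-mono-< (≰⇒> q) (≰⇒> q))))

    module ForwardEnds {u0 v0 : Fin n} (E : Enumeration u0 v0) where
      open EnumerationLemmas E

      S : Fin n → Bool
      S z = not (onCycleᵇ z) ∨ anyBelow k (λ t → eqb (x t) z ∧ eqb (partner z) (x (suc t)))

      onCycleᵇ-x : ∀ t → onCycleᵇ (x t) ≡ true
      onCycleᵇ-x t = onCycle⇒onCycleᵇ (onCycle-enumerated E t)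

      A : ℕ → ℕ → Bool
      A t s = eqb (x s) (x t) ∧ eqb (partner (x t)) (x (suc s))

      S-at : ∀ t → S (x t) ≡ eqb (partner (x t)) (x (suc t))
      S-at t = trans (cong (λ b → not b ∨ anyBelow k (A t)) (onCycleᵇ-x t)) (bool-ext f g)
        where
        f : anyBelow k (λ s → eqb (x s) (x t) ∧ eqb (partner (x t)) (x (suc s))) ≡ true → eqb (partner (x t)) (x (suc t)) ≡ true
        f h = let (s , ls , q) = anyBelow-elim {k} (A t) h in
          subst (λ w → eqb (partner (x t)) w ≡ true) (x-suc-cong (eqb-true (∧-true₁ q))) (∧-true₂ q)
        g : eqb (partner (x t)) (x (suc t)) ≡ true → anyBelow k (λ s → eqb (x s) (x t) ∧ eqb (partner (x t)) (x (suc s))) ≡ true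
        g h = let (r , lr , hr) = reachAfterShift 0 t in anyBelow-intro (A t) r lr (∧-intro (subst (λ w → eqb w (x t) ≡ true) (sym hr) (eqb-refl (x t)))
                 (subst (λ w → eqb (partner (x t)) w ≡ true) (sym (x-suc-cong hr)) h))

      S-offCycle : ∀ {z} → ¬ OnCycle C z → S z ≡ true
      S-offCycle nz = ∨-introl (cong not (offCycle⇒onCycleᵇ-false nz))

      predecessorIndex : ∀ {z} → OnCycle C z → ∃[ r ] x (suc r) ≡ z
      predecessorIndex {z} oz = let (t , lt , xt) = indexOf z oz ; (r , lr , hr) = reachAfterShift 1 t in r , trans hr xt

      x-skip-distinct : ∀ r → ¬ x r ≡ x (suc (suc r))
      x-skip-distinct r e = 0≢1+n (distinct-shifted r 0 2 lt0 (≤-trans (s≤s (s≤s (s≤s z≤n))) k≥3)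
                   (trans (cong x (+-identityʳ r)) (trans e (cong x (sym (trans (+-suc r 1) (cong suc (trans (+-suc r 0) (cong suc (+-identityʳ r)))))))))) 

      offCycle-≢x : ∀ {z} t → ¬ OnCycle C z → eqb z (x t) ≡ false
      offCycle-≢x t nz = eqb-false (λ e → nz (subst (OnCycle C) (sym e) (onCycle-enumerated E t)))

      S-complementary : ∀ z → S (partner z) ≡ not (S z)
      S-complementary z = go (onCycle? z)
        where
        go2 : OnCycle C z → ∀ r → x (suc r) ≡ z → Dec (OnCycle C (partner z)) → S (partner z) ≡ not (S z)
        go2 oz r xr (no npz) = trans (S-offCycle npz) (cong not (sym (trans (cong S (sym xr)) (trans (S-at (suc r)) (trans (cong (λ w → eqb (partner w) _) xr) (offCycle-≢x _ npz))))))
        go2 oz r xr (yes opz) with C-neighbours r (partner z) (subst (λ w → C w (partner z) ≡ true) (sym xr) (adj⇒cycleEdge oz opz (partner-adj z)))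
        ... | inj₁ q = trans (cong S q) (trans (S-at (suc (suc r))) (trans (cong (λ w → eqb w (x (suc (suc (suc r))))) (trans (cong partner (sym q)) (trans (partner-involutive z) (sym xr))))
                   (trans (eqb-false (x-skip-distinct (suc r))) (cong not (sym (trans (cong S (sym xr)) (trans (S-at (suc r)) (trans (cong (λ w → eqb (partner w) (x (suc (suc r)))) xr)
                     (trans (cong (λ w → eqb w (x (suc (suc r)))) q) (eqb-refl (x (suc (suc r)))))))))))))
        ... | inj₂ q = trans (cong S q) (trans (S-at r) (trans (cong (λ w → eqb w (x (suc r))) (trans (cong partner (sym q)) (trans (partner-involutive z) (sym xr)))) (trans (eqb-refl (x (suc r)))
                   (cong not (sym (trans (cong S (sym xr)) (trans (S-at (suc r)) (trans (cong (λ w → eqb (partner w) (x (suc (suc r)))) xr)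
                     (trans (cong (λ w → eqb w (x (suc (suc r)))) q) (eqb-false (x-skip-distinct r)))))))))))
        go : Dec (OnCycle C z) → S (partner z) ≡ not (S z)
        go (no nz) = let (r , xr) = predecessorIndex (offCycle-neighbourOnCycle nz (partner-adj z)) in
          trans (cong S (sym xr)) (trans (S-at (suc r)) (trans (cong (λ w → eqb w (x (suc (suc r)))) (trans (cong partner xr) (partner-involutive z)))
            (trans (offCycle-≢x (suc (suc r)) nz) (cong not (sym (S-offCycle nz))))))
        go (yes oz) = let (r , xr) = predecessorIndex oz in go2 oz r xr (onCycle? (partner z))

      S-nonconsecutive : ∀ t → S (x t) ≡ true → S (x (suc t)) ≡ true → ⊥
      S-nonconsecutive t h1 h2 = x-skip-distinct t (trans (sym (partner-involutive (x t))) (trans (cong partner p1) p2))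
        where p1 : partner (x t) ≡ x (suc t)
              p1 = eqb-true (trans (sym (S-at t)) h1)
              p2 : partner (x (suc t)) ≡ x (suc (suc t))
              p2 = eqb-true (trans (sym (S-at (suc t))) h2)

      S-leafEdge : ∀ {u z} → ¬ OnCycle C u → adj G u z ≡ true → S z ≡ true → ⊥
      S-leafEdge {u} {z} nu h hz = let (r , xr) = predecessorIndex (offCycle-neighbourOnCycle nu h) in
        true≢false (trans (sym hz) (trans (cong S (sym xr)) (trans (S-at (suc r)) (trans (cong (λ w → eqb w (x (suc (suc r)))) (trans (cong partner (trans xr (sym (partner-ofLeaf nu h)))) (partner-involutive u))) (offCycle-≢x _ nu)))))

      S-independent : Independentᵇ S
      S-independent u z hu hz = ¬-not λ h → go h (onCycle? u) (onCycle? z)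
        where
        go : adj G u z ≡ true → Dec (OnCycle C u) → Dec (OnCycle C z) → ⊥
        go h (no nu) (no nz) = nz (offCycle-neighbourOnCycle nu h)
        go h (no nu) (yes _) = S-leafEdge nu h hz
        go h (yes _) (no nz) = S-leafEdge nz (adj-symmetric h) hu
        go h (yes ou) (yes oz) with cedge (adj⇒cycleEdge ou oz h)
        ... | t , _ , inj₁ (p1 , p2) = S-nonconsecutive t (trans (cong S p1) hu) (trans (cong S p2) hz)
        ... | t , _ , inj₂ (p1 , p2) = S-nonconsecutive t (trans (cong S p2) hz) (trans (cong S p1) hu)

      S-maximum : MaximumIndependent G (tabulate S)
      S-maximum = complementary⇒maximum S S-independent S-complementary

    module AvoidingLeaf {v w : Fin n} (E : Enumeration v w) (nlv : ¬ OnCycle C (partner v)) (J : ℕ) (J≥1 : 1 ≤ J) (J<k : J < Enumeration.k E)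
                (gapOn : ∀ t → 1 ≤ t → t < J → OnCycle C (partner (Enumeration.x E t))) (Joff : ¬ OnCycle C (partner (Enumeration.x E J))) where
      open EnumerationLemmas E
      open ForwardEnds E using (x-skip-distinct; offCycle-≢x; predecessorIndex)

      ℓ : Fin n
      ℓ = partner v

      -- Which x t belong to S: v = x 0, then before J the vertices matched to their predecessor,
      -- after J those matched to their successor. Off the cycle S keeps every leaf except v's partner.
      cond : ℕ → Bool
      cond zero = true
      cond (suc t) = (ltᵇ (suc t) J ∧ eqb (partner (x (suc t))) (x t)) ∨ (ltᵇ J (suc t) ∧ eqb (partner (x (suc t))) (x (suc (suc t))))

      condGap : ∀ {i} → suc i < J → cond (suc i) ≡ eqb (partner (x (suc i))) (x i)
      condGap {i} h rewrite ltᵇ-yes h | ltᵇ-no (<-asym h) = BP.∨-identityʳ _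

      condRest : ∀ {i} → J < suc i → cond (suc i) ≡ eqb (partner (x (suc i))) (x (suc (suc i)))
      condRest {i} h rewrite ltᵇ-yes h | ltᵇ-no (<-asym h) = refl

      condJ : ∀ {i} → suc i ≡ J → cond (suc i) ≡ false
      condJ {i} refl rewrite ltᵇ-no (<-irrefl {suc i} refl) = refl

      A : Fin n → ℕ → Bool
      A z t = eqb (x t) z ∧ cond t

      S : Fin n → Bool
      S z = (not (onCycleᵇ z) ∧ not (eqb z ℓ)) ∨ anyBelow k (A z)

      onCycleᵇ-x : ∀ t → onCycleᵇ (x t) ≡ true
      onCycleᵇ-x t = onCycle⇒onCycleᵇ (onCycle-enumerated E t)

      S-at : ∀ t → t < k → S (x t) ≡ cond t
      S-at t lt = trans (cong (λ b → (not b ∧ not (eqb (x t) ℓ)) ∨ anyBelow k (A (x t))) (onCycleᵇ-x t)) (bool-ext f g)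
        where
        f : anyBelow k (A (x t)) ≡ true → cond t ≡ true
        f h = let (s , ls , q) = anyBelow-elim {k} (A (x t)) h in subst (λ j → cond j ≡ true) (D s t ls lt (eqb-true (∧-true₁ q))) (∧-true₂ q)
        g : cond t ≡ true → anyBelow k (A (x t)) ≡ true
        g h = anyBelow-intro (A (x t)) t lt (∧-intro (eqb-refl (x t)) h)

      S-offCycle : ∀ {z} → ¬ OnCycle C z → S z ≡ not (eqb z ℓ)
      S-offCycle {z} nz = trans (cong (λ b → (not b ∧ not (eqb z ℓ)) ∨ anyBelow k (A z)) (offCycle⇒onCycleᵇ-false nz)) (l (not (eqb z ℓ)) (anyBelow k (A z)) (¬-not λ h → let (s , ls , q) = anyBelow-elim {k} (A z) h in nz (subst (OnCycle C) (eqb-true (∧-true₁ q)) (onCycle-enumerated E s))))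
        where l : ∀ a b → b ≡ false → (true ∧ a) ∨ b ≡ a
              l a b refl = BP.∨-identityʳ a

      v∈S : S v ≡ true
      v∈S = subst (λ q → S q ≡ true) x0 (S-at 0 lt0)

      leaf∉S : S ℓ ≡ false
      leaf∉S = trans (S-offCycle nlv) (cong not (eqb-refl ℓ))

      partner-x0 : partner (x 0) ≡ ℓ
      partner-x0 = cong partner x0

      condOff : ∀ i → ¬ OnCycle C (partner (x (suc i))) → cond (suc i) ≡ false
      condOff i np with <-cmp (suc i) J
      ... | tri< h _ _ = trans (condGap h) (offCycle-≢x i np)
      ... | tri≈ _ h _ = condJ h
      ... | tri> _ _ h = trans (condRest h) (offCycle-≢x (suc (suc i)) np)

      k≡ : ∀ {t} → suc t ≡ k → x (suc t) ≡ v
      k≡ e = trans (cong x e) (trans xk x0)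

      pvOn : ∀ {z} → partner z ≡ v → OnCycle C z → ⊥
      pvOn {z} e oz = nlv (subst (OnCycle C) (sym (trans (cong partner (sym e)) (partner-involutive z))) oz)

      ssiJ : ∀ {i} → suc i < J → suc (suc i) < k ⊎ suc (suc i) ≡ J
      ssiJ {i} h with m≤n⇒m<n∨m≡n h
      ... | inj₁ q = inj₁ (<-trans q J<k)
      ... | inj₂ q = inj₂ q

      S-complementary-partnerLeaf : ∀ {z} i → suc i < k → x (suc i) ≡ z → ¬ OnCycle C (partner z) → S (partner z) ≡ not (S z)
      S-complementary-partnerLeaf {z} i lt xz npz = trans (S-offCycle npz) (trans (cong not (eqb-false pzℓ)) (cong not (sym Sz)))
        where
        Sz : S z ≡ false
        Sz = trans (cong S (sym xz)) (trans (S-at (suc i) lt) (condOff i (subst (λ q → ¬ OnCycle C (partner q)) (sym xz) npz)))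
        pzℓ : ¬ partner z ≡ ℓ
        pzℓ e = 0≢1+n (D 0 (suc i) lt0 lt (trans x0 (trans (sym (partner-injective e)) (sym xz))))

      S-complementary-partnerBefore : ∀ {z} i → suc i < k → x (suc i) ≡ z → partner z ≡ x i → OnCycle C (partner z) → S (partner z) ≡ not (S z)
      S-complementary-partnerBefore {z} i lt xz q opz with <-cmp (suc i) J
      ... | tri≈ _ e _ = ⊥-elim (Joff (subst (λ q → OnCycle C (partner q)) (trans (sym xz) (cong x e)) opz))
      ... | tri< h _ _ = trans (cong S q) (trans (Six i refl) (cong not (sym Sz)))
        where
        Sz : S z ≡ true
        Sz = trans (cong S (sym xz)) (trans (S-at (suc i) lt) (trans (condGap h) (trans (cong (λ w → eqb (partner w) (x i)) xz) (trans (cong (λ w → eqb w (x i)) q) (eqb-refl (x i))))))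
        Six : ∀ j → i ≡ j → S (x i) ≡ false
        Six zero e = ⊥-elim (pvOn (trans q (trans (cong x e) x0)) (subst (OnCycle C) xz (onCycle-enumerated E (suc i))))
        Six (suc i') e = subst (λ w → S (x w) ≡ false) (sym e) (trans (S-at (suc i') (<-trans (n<1+n (suc i')) lt')) (trans (condGap (<-trans (n<1+n (suc i')) h'))
                         (trans (cong (λ w → eqb w (x i')) (trans (cong partner (sym q')) (trans (partner-involutive z) (sym xz')))) (eqb-false (λ e → x-skip-distinct i' (sym e))))))
          where q' : partner z ≡ x (suc i')
                q' = trans q (cong x e)
                lt' : suc (suc i') < k
                lt' = subst (λ w → suc w < k) e lt
                h' : suc (suc i') < J
                h' = subst (λ w → suc w < J) e h
                xz' : x (suc (suc i')) ≡ z
                xz' = subst (λ w → x (suc w) ≡ z) e xz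
      ... | tri> _ _ h = trans (cong S q) (trans Si (cong not (sym Sz)))
        where
        Sz : S z ≡ false
        Sz = trans (cong S (sym xz)) (trans (S-at (suc i) lt) (trans (condRest h) (trans (cong (λ w → eqb (partner w) (x (suc (suc i)))) xz) (trans (cong (λ w → eqb w (x (suc (suc i)))) q) (eqb-false (x-skip-distinct i))))))
        ppz : partner (x i) ≡ x (suc i)
        ppz = trans (cong partner (sym q)) (trans (partner-involutive z) (sym xz))
        Si : S (x i) ≡ true
        Si with m≤n⇒m<n∨m≡n (≤-pred h)
        ... | inj₂ e = ⊥-elim (Joff (subst (λ w → OnCycle C (partner (x w))) (sym e) (subst (OnCycle C) (sym ppz) (onCycle-enumerated E (suc i)))))
        ... | inj₁ h' = Si' i refl
          where
          Si' : ∀ j → i ≡ j → S (x i) ≡ true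
          Si' zero e = ⊥-elim (n≮0 (subst (J <_) e h'))
          Si' (suc i') e = subst (λ w → S (x w) ≡ true) (sym e) (trans (S-at (suc i') (<-trans (n<1+n (suc i')) lt')) (trans (condRest h'') (trans (cong (λ w → eqb w (x (suc (suc i')))) ppz') (eqb-refl (x (suc (suc i')))))))
            where lt' : suc (suc i') < k
                  lt' = subst (λ w → suc w < k) e lt
                  h'' : J < suc i'
                  h'' = subst (J <_) e h'
                  ppz' : partner (x (suc i')) ≡ x (suc (suc i'))
                  ppz' = subst (λ w → partner (x w) ≡ x (suc w)) e ppz

      S-complementary-partnerAfter : ∀ {z} i → suc i < k → x (suc i) ≡ z → partner z ≡ x (suc (suc i)) → OnCycle C (partner z) → S (partner z) ≡ not (S z)
      S-complementary-partnerAfter {z} i lt xz q opz with <-cmp (suc i) J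
      ... | tri≈ _ e _ = ⊥-elim (Joff (subst (λ q → OnCycle C (partner q)) (trans (sym xz) (cong x e)) opz))
      ... | tri< h _ _ = trans (cong S q) (trans Sss (cong not (sym Sz)))
        where
        Sz : S z ≡ false
        Sz = trans (cong S (sym xz)) (trans (S-at (suc i) lt) (trans (condGap h) (trans (cong (λ w → eqb (partner w) (x i)) xz) (trans (cong (λ w → eqb w (x i)) q) (eqb-false (λ e → x-skip-distinct i (sym e)))))))
        ppz : partner (x (suc (suc i))) ≡ x (suc i)
        ppz = trans (cong partner (sym q)) (trans (partner-involutive z) (sym xz))
        Sss : S (x (suc (suc i))) ≡ true
        Sss with ssiJ h
        ... | inj₂ e = ⊥-elim (Joff (subst (λ w → OnCycle C (partner (x w))) e (subst (OnCycle C) (sym ppz) (onCycle-enumerated E (suc i)))))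
        ... | inj₁ sl with <-cmp (suc (suc i)) J
        ...   | tri< h2 _ _ = trans (S-at _ sl) (trans (condGap h2) (trans (cong (λ w → eqb w (x (suc i))) ppz) (eqb-refl (x (suc i)))))
        ...   | tri≈ _ e _ = ⊥-elim (Joff (subst (λ w → OnCycle C (partner (x w))) e (subst (OnCycle C) (sym ppz) (onCycle-enumerated E (suc i)))))
        ...   | tri> _ _ h2 = ⊥-elim (<-irrefl refl (<-≤-trans h2 h))
      ... | tri> _ _ h = trans (cong S q) (trans Sss (cong not (sym Sz)))
        where
        Sz : S z ≡ true
        Sz = trans (cong S (sym xz)) (trans (S-at (suc i) lt) (trans (condRest h) (trans (cong (λ w → eqb (partner w) (x (suc (suc i)))) xz) (trans (cong (λ w → eqb w (x (suc (suc i)))) q) (eqb-refl (x (suc (suc i))))))))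
        ppz : partner (x (suc (suc i))) ≡ x (suc i)
        ppz = trans (cong partner (sym q)) (trans (partner-involutive z) (sym xz))
        Sss : S (x (suc (suc i))) ≡ false
        Sss with m≤n⇒m<n∨m≡n lt
        ... | inj₂ e = ⊥-elim (pvOn (trans q (k≡ e)) (subst (OnCycle C) xz (onCycle-enumerated E (suc i))))
        ... | inj₁ sl = trans (S-at _ sl) (trans (condRest (<-trans h (n<1+n (suc i)))) (trans (cong (λ w → eqb w (x (suc (suc (suc i))))) ppz) (eqb-false (x-skip-distinct (suc i)))))

      S-complementary-offCycle : ∀ {z} → ¬ OnCycle C z → Dec (z ≡ ℓ) → S (partner z) ≡ not (S z)
      S-complementary-offCycle {z} nz (yes e) = trans (cong S (trans (cong partner e) (partner-involutive v))) (trans v∈S (sym (cong not (trans (cong S e) leaf∉S))))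
      S-complementary-offCycle {z} nz (no ne) with indexOf _ (offCycle-neighbourOnCycle nz (partner-adj z))
      ... | zero , _ , xt = ⊥-elim (ne (trans (sym (partner-involutive z)) (cong partner (trans (sym xt) x0))))
      ... | suc i , lt , xt = trans (cong S (sym xt)) (trans (S-at (suc i) lt) (trans (condOff i (subst (λ q → ¬ OnCycle C q) (sym (trans (cong partner xt) (partner-involutive z))) nz))
                                  (cong not (sym (trans (S-offCycle nz) (cong not (eqb-false ne)))))))

      S-complementary : ∀ z → S (partner z) ≡ not (S z)
      S-complementary z = byCase (onCycle? z)
        where
        fromIndex : ∀ i → suc i < k → x (suc i) ≡ z → Dec (OnCycle C (partner z)) → S (partner z) ≡ not (S z)
        fromIndex i lt xt (no npz) = S-complementary-partnerLeaf i lt xt npz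
        fromIndex i lt xt (yes opz) with C-neighbours i (partner z) (subst (λ q → C q (partner z) ≡ true) (sym xt) (adj⇒cycleEdge (subst (OnCycle C) xt (onCycle-enumerated E (suc i))) opz (partner-adj z)))
        ... | inj₁ q = S-complementary-partnerAfter i lt xt q opz
        ... | inj₂ q = S-complementary-partnerBefore i lt xt q opz
        byCase : Dec (OnCycle C z) → S (partner z) ≡ not (S z)
        byCase (no nz) = S-complementary-offCycle nz (z ≟ ℓ)
        byCase (yes oz) with indexOf _ oz
        ... | zero , _ , xt = trans (cong S (trans (cong partner (sym xt)) partner-x0)) (trans leaf∉S (cong not (sym (trans (cong S (sym xt)) (S-at 0 lt0)))))
        ... | suc i , lt , xt = fromIndex i lt xt (onCycle? (partner z))

      S-nonconsecutive : ∀ t → t < k → S (x t) ≡ true → S (x (suc t)) ≡ true → ⊥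
      S-nonconsecutive t lt h1 h2 with m≤n⇒m<n∨m≡n lt
      S-nonconsecutive zero lt h1 h2 | inj₂ e = <-irrefl e (≤-trans (s≤s (s≤s z≤n)) k≥3)
      S-nonconsecutive (suc i) lt h1 h2 | inj₂ e with <-cmp (suc i) J
      ... | tri< h _ _ = <-irrefl refl (<-≤-trans h (≤-pred (subst (J <_) (sym e) J<k)))
      ... | tri≈ _ h _ = true≢false (trans (sym h1) (trans (S-at (suc i) lt) (condJ h)))
      ... | tri> _ _ h = pvOn (trans (eqb-true (trans (sym (condRest h)) (trans (sym (S-at (suc i) lt)) h1))) (k≡ e)) (onCycle-enumerated E (suc i))
      S-nonconsecutive zero lt h1 h2 | inj₁ sl with <-cmp 1 J
      ... | tri< h _ _ = pvOn (trans (eqb-true (trans (sym (condGap h)) (trans (sym (S-at 1 sl)) h2))) x0) (onCycle-enumerated E 1)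
      ... | tri≈ _ h _ = true≢false (trans (sym h2) (trans (S-at 1 sl) (condJ h)))
      ... | tri> _ _ h = 1+n≰n (≤-trans J≥1 (≤-pred h))
      S-nonconsecutive (suc i) lt h1 h2 | inj₁ sl with <-cmp (suc i) J
      ... | tri≈ _ h _ = true≢false (trans (sym h1) (trans (S-at (suc i) lt) (condJ h)))
      ... | tri< h _ _ with <-cmp (suc (suc i)) J
      ...   | tri≈ _ h2' _ = true≢false (trans (sym h2) (trans (S-at _ sl) (condJ h2')))
      ...   | tri> _ _ h2' = <-irrefl refl (<-≤-trans h2' h)
      ...   | tri< h2' _ _ = x-skip-distinct i (sym (trans (sym (partner-involutive (x (suc (suc i))))) (trans (cong partner a2) a1)))
        where a1 : partner (x (suc i)) ≡ x i
              a1 = eqb-true (trans (sym (condGap h)) (trans (sym (S-at (suc i) lt)) h1))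
              a2 : partner (x (suc (suc i))) ≡ x (suc i)
              a2 = eqb-true (trans (sym (condGap h2')) (trans (sym (S-at _ sl)) h2))
      S-nonconsecutive (suc i) lt h1 h2 | inj₁ sl | tri> _ _ h = x-skip-distinct (suc i) (trans (sym (partner-involutive (x (suc i)))) (trans (cong partner a1) a2))
        where a1 : partner (x (suc i)) ≡ x (suc (suc i))
              a1 = eqb-true (trans (sym (condRest h)) (trans (sym (S-at (suc i) lt)) h1))
              a2 : partner (x (suc (suc i))) ≡ x (suc (suc (suc i)))
              a2 = eqb-true (trans (sym (condRest (<-trans h (n<1+n (suc i))))) (trans (sym (S-at _ sl)) h2))

      S-leafEdge : ∀ {u z} → ¬ OnCycle C u → adj G u z ≡ true → S u ≡ true → S z ≡ true → ⊥
      S-leafEdge {u} {z} nu h hu hz with indexOf _ (offCycle-neighbourOnCycle nu h)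
      ... | zero , _ , xt = true≢false (trans (sym hu) (trans (S-offCycle nu) (cong not (≡⇒eqb (trans (sym (partner-involutive u)) (cong partner (trans (partner-ofLeaf nu h) (trans (sym xt) x0))))))))
      ... | suc i , lt , xt = true≢false (trans (sym hz) (trans (cong S (sym xt)) (trans (S-at (suc i) lt) (condOff i (subst (λ q → ¬ OnCycle C q) (sym (trans (cong partner (trans xt (sym (partner-ofLeaf nu h)))) (partner-involutive u))) nu)))))

      S-independent : Independentᵇ S
      S-independent u z hu hz = ¬-not λ h → go h (onCycle? u) (onCycle? z)
        where
        go : adj G u z ≡ true → Dec (OnCycle C u) → Dec (OnCycle C z) → ⊥
        go h (no nu) (no nz) = nz (offCycle-neighbourOnCycle nu h)
        go h (no nu) (yes _) = S-leafEdge nu h hu hz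
        go h (yes _) (no nz) = S-leafEdge nz (adj-symmetric h) hz hu
        go h (yes ou) (yes oz) with cedge (adj⇒cycleEdge ou oz h)
        ... | t , lt , inj₁ (p1 , p2) = S-nonconsecutive t lt (trans (cong S p1) hu) (trans (cong S p2) hz)
        ... | t , lt , inj₂ (p1 , p2) = S-nonconsecutive t lt (trans (cong S p2) hz) (trans (cong S p1) hu)

      S-maximum : MaximumIndependent G (tabulate S)
      S-maximum = complementary⇒maximum S S-independent S-complementary

    excellent-offCycle : ∀ {v} → ¬ OnCycle C v → InMaximumIndependent v
    excellent-offCycle nv =
      let (u , w , h) = someOnCycle ; E = enumerate u w h in
      tabulate (ForwardEnds.S E) , ForwardEnds.S-maximum E , tab-∈ (ForwardEnds.S-offCycle E nv)

    excellent-partnerOnCycle : ∀ {v} → OnCycle C v → OnCycle C (partner v) → InMaximumIndependent v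
    excellent-partnerOnCycle {v} ov opv = tabulate (ForwardEnds.S E) , ForwardEnds.S-maximum E , tab-∈ v∈S
      where
      E : Enumeration v (partner v)
      E = enumerate v (partner v) (adj⇒cycleEdge ov opv (partner-adj v))
      v∈S : ForwardEnds.S E v ≡ true
      v∈S = trans (cong (ForwardEnds.S E) (sym (Enumeration.x0 E))) (trans (ForwardEnds.S-at E 0) (trans (cong₂ (λ a b → eqb (partner a) b) (Enumeration.x0 E) (Enumeration.x1 E)) (eqb-refl (partner v))))

    legOnCycleOtherThan : AtLeastTwoLegs G → ∀ v → ∃[ c ] (OnCycle C c × ¬ OnCycle C (partner c) × ¬ c ≡ v)
    legOnCycleOtherThan legs v with twoLegs⇒twoLeaves legs
    ... | l1 , l2 , o1 , o2 , l1≢l2 with partner l1 ≟ v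
    ...   | yes e = partner l2 , offCycle-neighbourOnCycle o2 (partner-adj l2) , subst (λ q → ¬ OnCycle C q) (sym (partner-involutive l2)) o2 , λ e2 → l1≢l2 (partner-injective (trans e (sym e2)))
    ...   | no ne = partner l1 , offCycle-neighbourOnCycle o1 (partner-adj l1) , subst (λ q → ¬ OnCycle C q) (sym (partner-involutive l1)) o1 , ne

    -- J is the first index after 0 at which the partner of x J is a leaf; c guarantees that it exists.
    excellent-partnerLeaf : ∀ {v} → OnCycle C v → ¬ OnCycle C (partner v) →
      ∃[ c ] (OnCycle C c × ¬ OnCycle C (partner c) × ¬ c ≡ v) → InMaximumIndependent v
    excellent-partnerLeaf {v} ov nlv (c , oc , nlc , cv) = tabulate L.S , L.S-maximum , tab-∈ L.v∈S
      where
      E : Enumeration v (proj₁ ov)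
      E = enumerate v (proj₁ ov) (proj₂ ov)
      k : ℕ
      k = Enumeration.k E
      x : ℕ → Fin n
      x = Enumeration.x E
      P : ℕ → Bool
      P t = not (onCycleᵇ (partner (x (suc t))))
      r0info : ∃[ r0 ] (suc r0 < k × P r0 ≡ true)
      r0info with EnumerationLemmas.indexOf E c oc
      ... | zero , _ , xt = ⊥-elim (cv (trans (sym xt) (Enumeration.x0 E)))
      ... | suc r0 , lt , xt = r0 , lt , cong not (offCycle⇒onCycleᵇ-false (subst (λ q → ¬ OnCycle C (partner q)) (sym xt) nlc))
      r0 : ℕ
      r0 = proj₁ r0info
      mn : ∃[ j ] (P j ≡ true × ∀ i → i < j → P i ≡ false)
      mn = leastWitness P r0 r0 ≤-refl (proj₂ (proj₂ r0info))
      j0 : ℕ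
      j0 = proj₁ mn
      Pj0 : P j0 ≡ true
      Pj0 = proj₁ (proj₂ mn)
      Pbelow : ∀ i → i < j0 → P i ≡ false
      Pbelow = proj₂ (proj₂ mn)
      j0≤r0 : j0 ≤ r0
      j0≤r0 with j0 ≤? r0
      ... | yes q = q
      ... | no q = ⊥-elim (true≢false (trans (sym (proj₂ (proj₂ r0info))) (Pbelow r0 (≰⇒> q))))
      J<k : suc j0 < k
      J<k = ≤-<-trans (s≤s j0≤r0) (proj₁ (proj₂ r0info))
      gapOn : ∀ t → 1 ≤ t → t < suc j0 → OnCycle C (partner (x t))
      gapOn (suc i) _ lt = onCycleᵇ-true (not-false⁻¹ (Pbelow i (≤-pred lt)))
      Joff : ¬ OnCycle C (partner (x (suc j0)))
      Joff = onCycleᵇ-false (not-true Pj0)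
      module L = AvoidingLeaf E nlv (suc j0) (s≤s z≤n) J<k gapOn Joff

  matching⇒legs⇒alphaExcellent : HasPerfectMatching G → AtLeastTwoLegs G → AlphaExcellent G
  matching⇒legs⇒alphaExcellent (M , sM , dM) legs v = byCase (onCycle? v) (onCycle? (partner v))
    where
    open PerfectMatching M sM dM
    byCase : Dec (OnCycle C v) → Dec (OnCycle C (partner v)) → InMaximumIndependent v
    byCase (no nv) _ = excellent-offCycle nv
    byCase (yes ov) (yes opv) = excellent-partnerOnCycle ov opv
    byCase (yes ov) (no nlv) = excellent-partnerLeaf ov nlv (legOnCycleOtherThan legs v)

  onCycle⇒≢offCycle : ∀ {a b} → OnCycle C a → ¬ OnCycle C b → ¬ a ≡ b
  onCycle⇒≢offCycle oa nb refl = nb oa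

  -- α-excellence forces a perfect matching

  -- Swapping c for its two leaves enlarges a maximum independent set containing c.
  module SwapForTwoLeaves {c l1 l2 : Fin n} (S : Subset n) (mx : MaximumIndependent G S) (Sc : lookup S c ≡ true)
     (n1 : ¬ OnCycle C l1) (n2 : ¬ OnCycle C l2) (h1 : adj G c l1 ≡ true) (h2 : adj G c l2 ≡ true) (ne : ¬ l1 ≡ l2) where
    oc : OnCycle C c
    oc = offCycle-neighbourOnCycle n1 (adj-symmetric h1)
    IS : Independentᵇ (lookup S)
    IS = independentᵇ-lookup {S} (proj₁ mx)
    Sl1 : lookup S l1 ≡ false
    Sl1 = independent-edge IS h1 Sc
    Sl2 : lookup S l2 ≡ false
    Sl2 = independent-edge IS h2 Sc
    e : ℕ → Fin n
    e zero = c
    e (suc zero) = l1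
    e (suc (suc _)) = l2
    cl1 : ¬ c ≡ l1
    cl1 = onCycle⇒≢offCycle oc n1
    cl2 : ¬ c ≡ l2
    cl2 = onCycle⇒≢offCycle oc n2
    De : Distinct e 3
    De zero zero _ _ _ = refl
    De zero (suc zero) _ _ q = ⊥-elim (cl1 q)
    De zero (suc (suc zero)) _ _ q = ⊥-elim (cl2 q)
    De (suc zero) zero _ _ q = ⊥-elim (cl1 (sym q))
    De (suc zero) (suc zero) _ _ _ = refl
    De (suc zero) (suc (suc zero)) _ _ q = ⊥-elim (ne q)
    De (suc (suc zero)) zero _ _ q = ⊥-elim (cl2 (sym q))
    De (suc (suc zero)) (suc zero) _ _ q = ⊥-elim (ne (sym q))
    De (suc (suc zero)) (suc (suc zero)) _ _ _ = refl
    De (suc (suc (suc _))) _ (s≤s (s≤s (s≤s ()))) _ _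
    De _ (suc (suc (suc _))) _ (s≤s (s≤s (s≤s ()))) _
    T : Fin n → Bool
    T z = (lookup S z ∧ not (eqb z c)) ∨ (eqb z l1 ∨ eqb z l2)
    agree : ∀ z → inRange e 3 z ≡ false → lookup S z ≡ T z
    agree z h rewrite eqb-false {a = z} {b = c} (λ q → inRange-false {e = e} {m = 3} h 0 (s≤s z≤n) (sym q)) | eqb-false {a = z} {b = l1} (λ q → inRange-false {e = e} {m = 3} h 1 (s≤s (s≤s z≤n)) (sym q))
                    | eqb-false {a = z} {b = l2} (λ q → inRange-false {e = e} {m = 3} h 2 (s≤s (s≤s (s≤s z≤n))) (sym q)) = sym (trans (BP.∨-identityʳ _) (BP.∧-identityʳ (lookup S z)))
    Tc : T c ≡ false
    Tc rewrite eqb-refl c | eqb-false {a = c} {b = l1} cl1 | eqb-false {a = c} {b = l2} cl2 = trans (BP.∨-identityʳ _) (BP.∧-zeroʳ (lookup S c))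
    Tl1 : T l1 ≡ true
    Tl1 = ∨-intror {lookup S l1 ∧ not (eqb l1 c)} (∨-introl (eqb-refl l1))
    Tl2 : T l2 ≡ true
    Tl2 = ∨-intror {lookup S l2 ∧ not (eqb l2 c)} (∨-intror {eqb l2 l1} (eqb-refl l2))
    sumT : sumBelow 3 (λ t → bit (T (e t))) ≡ suc (sumBelow 3 (λ t → bit (lookup S (e t))))
    sumT rewrite Tc | Tl1 | Tl2 | Sc | Sl1 | Sl2 = refl
    Tel : ∀ {u} → T u ≡ true → (lookup S u ≡ true × ¬ u ≡ c) ⊎ (u ≡ l1 ⊎ u ≡ l2)
    Tel {u} h with ∨-elim {lookup S u ∧ not (eqb u c)} h
    ... | inj₁ q = inj₁ (∧-true₁ q , λ e → true≢false (trans (sym (∧-true₂ q)) (cong not (≡⇒eqb e))))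
    ... | inj₂ q with ∨-elim {eqb u l1} q
    ...   | inj₁ q1 = inj₂ (inj₁ (eqb-true q1))
    ...   | inj₂ q2 = inj₂ (inj₂ (eqb-true q2))
    leafNb : ∀ {u z} → u ≡ l1 ⊎ u ≡ l2 → adj G u z ≡ true → z ≡ c
    leafNb (inj₁ refl) h = offCycle-uniqueNeighbour n1 h (adj-symmetric h1)
    leafNb (inj₂ refl) h = offCycle-uniqueNeighbour n2 h (adj-symmetric h2)
    IT : Independentᵇ T
    IT u z hu hz = ¬-not λ h → go (Tel hu) (Tel hz) h
      where
      go : _ → _ → adj G u z ≡ true → ⊥
      go (inj₁ (su , _)) (inj₁ (sz , _)) h = true≢false (trans (sym h) (IS u z su sz))
      go (inj₂ lu) _ h = true≢false (trans (sym hz) (trans (cong T (leafNb lu h)) Tc))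
      go (inj₁ (_ , uc)) (inj₂ lz) h = uc (leafNb lz (adj-symmetric h))

    absurd : ⊥
    absurd = noImprovingSwap mx T IT e 3 De agree (≤-reflexive (sym sumT))

  excellent⇒leafUnique : AlphaExcellent G → ∀ {c l1 l2} → ¬ OnCycle C l1 → ¬ OnCycle C l2 → adj G c l1 ≡ true → adj G c l2 ≡ true → l1 ≡ l2
  excellent⇒leafUnique ex {c} {l1} {l2} n1 n2 h1 h2 with l1 ≟ l2
  ... | yes e = e
  ... | no ne = let (S , mx , c∈S) = ex c in ⊥-elim (SwapForTwoLeaves.absurd S mx (∈-vec c∈S) n1 n2 h1 h2 ne)

  Leafless : Fin n → Set
  Leafless c = ∀ w → adj G c w ≡ true → OnCycle C w

  -- If x 0 ∈ S, then ℓa, x 1 ∉ S; swapping S on ℓa, x 0, …, x (L + 1), ℓb for ℓa, ℓb and the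
  -- odd-indexed x i gains a vertex when the number L of leafless vertices in between is odd.
  module OddGapBetweenLegs {u0 v0 : Fin n} (E : Enumeration u0 v0) (S : Subset n) (mx : MaximumIndependent G S)
     (Sx0 : lookup S (Enumeration.x E 0) ≡ true)
     (ℓa : Fin n) (na : ¬ OnCycle C ℓa) (ha : adj G (Enumeration.x E 0) ℓa ≡ true)
     (L : ℕ) (oL : odd L ≡ true) (Lk : suc L < Enumeration.k E)
     (ℓb : Fin n) (nb : ¬ OnCycle C ℓb) (hb : adj G (Enumeration.x E (suc L)) ℓb ≡ true)
     (nl : ∀ t → 1 ≤ t → t ≤ L → Leafless (Enumeration.x E t)) where
    open EnumerationLemmas E

    Sf : Fin n → Bool
    Sf = lookup S
    IS : Independentᵇ Sf
    IS = independentᵇ-lookup {S} (proj₁ mx)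

    e : ℕ → Fin n
    e zero = ℓa
    e (suc i) = if≤ i (suc L) (x i) ℓb

    m : ℕ
    m = suc (suc (suc (suc L)))

    eS : ∀ i → i ≤ suc L → e (suc i) ≡ x i
    eS i le = if≤-yes le

    eL : e (suc (suc (suc L))) ≡ ℓb
    eL = if≤-no {suc (suc L)} {suc L} (λ q → <-irrefl refl q)

    data View : ℕ → Set where
      vw0 : View 0
      vx : ∀ i → i ≤ suc L → View (suc i)
      vL : View (suc (suc (suc L)))

    view : ∀ t → t < m → View t
    view zero _ = vw0
    view (suc i) lt with m≤n⇒m<n∨m≡n (≤-pred lt)
    ... | inj₁ q = vx i (≤-pred (≤-pred q))
    ... | inj₂ refl = vL

    xi≤ : ∀ {i} → i ≤ suc L → i < k
    xi≤ le = ≤-<-trans le Lk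

    ab : ¬ ℓa ≡ ℓb
    ab q = 0≢1+n (D 0 (suc L) lt0 Lk (offCycle-uniqueNeighbour na (adj-symmetric ha) (subst (λ w → adj G w (x (suc L)) ≡ true) (sym q) (adj-symmetric hb))))

    xa : ∀ i → ¬ x i ≡ ℓa
    xa i = onCycle⇒≢offCycle (onCycle-enumerated E i) na
    xb : ∀ i → ¬ x i ≡ ℓb
    xb i = onCycle⇒≢offCycle (onCycle-enumerated E i) nb

    De : Distinct e m
    De a b la lb q = go (view a la) (view b lb) q
      where
      go : ∀ {a b} → View a → View b → e a ≡ e b → a ≡ b
      go vw0 vw0 _ = refl
      go vw0 (vx i le) q = ⊥-elim (xa i (sym (trans q (eS i le))))
      go vw0 vL q = ⊥-elim (ab (trans q eL))
      go (vx i le) vw0 q = ⊥-elim (xa i (trans (sym (eS i le)) q))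
      go (vx i le) (vx j le') q = cong suc (D i j (xi≤ le) (xi≤ le') (trans (sym (eS i le)) (trans q (eS j le'))))
      go (vx i le) vL q = ⊥-elim (xb i (trans (sym (eS i le)) (trans q eL)))
      go vL vw0 q = ⊥-elim (ab (sym (trans (sym eL) q)))
      go vL (vx i le) q = ⊥-elim (xb i (trans (sym (eS i le)) (trans (sym q) eL)))
      go vL vL _ = refl

    eadj : ∀ t → suc t < m → adj G (e t) (e (suc t)) ≡ true
    eadj t lt with view t (<-trans (n<1+n t) lt)
    ... | vw0 = subst (λ w → adj G ℓa w ≡ true) (sym (eS 0 z≤n)) (adj-symmetric ha)
    ... | vL = ⊥-elim (<-irrefl refl (≤-pred lt))
    ... | vx i le with m≤n⇒m<n∨m≡n le
    ...   | inj₁ q = subst₂ (λ a b → adj G a b ≡ true) (sym (eS i le)) (sym (eS (suc i) q)) (C⊆G (edge i))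
    ...   | inj₂ refl = subst₂ (λ a b → adj G a b ≡ true) (sym (eS i le)) (sym eL) hb

    T : Fin n → Bool
    T z = (Sf z ∧ not (inRange e m z)) ∨ (eqb z ℓa ∨ (eqb z ℓb ∨ anyBelow (suc L) (λ i → odd i ∧ eqb (x i) z)))

    inW : ∀ i → i ≤ suc L → inRange e m (x i) ≡ true
    inW i le = subst (λ w → inRange e m w ≡ true) (eS i le) (inRange-intro e (suc i) (s≤s (s≤s (≤-trans le (n≤1+n _)))))

    oddSL : odd (suc L) ≡ false
    oddSL = cong not oL

    Tx : ∀ i → i ≤ suc L → T (x i) ≡ odd i
    Tx i le = bool-ext f g
      where
      f : T (x i) ≡ true → odd i ≡ true
      f h with ∨-elim {Sf (x i) ∧ not (inRange e m (x i))} h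
      ... | inj₁ q = ⊥-elim (true≢false (trans (sym (∧-true₂ q)) (cong not (inW i le))))
      ... | inj₂ q with ∨-elim {eqb (x i) ℓa} q
      ...   | inj₁ q1 = ⊥-elim (xa i (eqb-true q1))
      ...   | inj₂ q2 with ∨-elim {eqb (x i) ℓb} q2
      ...     | inj₁ q3 = ⊥-elim (xb i (eqb-true q3))
      ...     | inj₂ q4 = let (j , lj , r) = anyBelow-elim {suc L} (λ j → odd j ∧ eqb (x j) (x i)) q4 in
                  subst (λ w → odd w ≡ true) (D j i (xi≤ (<⇒≤ lj)) (xi≤ le) (eqb-true (∧-true₂ r))) (∧-true₁ r)
      g : odd i ≡ true → T (x i) ≡ true
      g o = ∨-intror {Sf (x i) ∧ not (inRange e m (x i))} (∨-intror {eqb (x i) ℓa} (∨-intror {eqb (x i) ℓb}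
             (anyBelow-intro (λ j → odd j ∧ eqb (x j) (x i)) i lt' (∧-intro o (eqb-refl (x i))))))
        where lt' : i < suc L
              lt' with m≤n⇒m<n∨m≡n le
              ... | inj₁ q = q
              ... | inj₂ refl = ⊥-elim (true≢false (trans (sym o) oddSL))

    Tℓa : T ℓa ≡ true
    Tℓa = ∨-intror {Sf ℓa ∧ not (inRange e m ℓa)} (∨-introl (eqb-refl ℓa))
    Tℓb : T ℓb ≡ true
    Tℓb = ∨-intror {Sf ℓb ∧ not (inRange e m ℓb)} (∨-intror {eqb ℓb ℓa} (∨-introl (eqb-refl ℓb)))

    agree : ∀ z → inRange e m z ≡ false → Sf z ≡ T z
    agree z h = sym (trans (cong₂ (λ a b → (Sf z ∧ not (inRange e m z)) ∨ (a ∨ b)) (eqb-false (λ q → inRange-false {e = e} {m = m} h 0 (s≤s z≤n) (sym q)))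
         (cong₂ _∨_ (eqb-false (λ q → inRange-false {e = e} {m = m} h (suc (suc (suc L))) ≤-refl (trans eL (sym q))))
             (¬-not λ r → let (j , lj , r') = anyBelow-elim {suc L} (λ j → odd j ∧ eqb (x j) z) r in
                inRange-false {e = e} {m = m} h (suc j) (≤-trans (s≤s lj) (≤-trans (n≤1+n _) (n≤1+n _))) (trans (eS j (<⇒≤ lj)) (eqb-true (∧-true₂ r'))))))
         (trans (cong (λ w → (Sf z ∧ not w) ∨ false) h) (trans (BP.∨-identityʳ _) (BP.∧-identityʳ (Sf z)))))

    gT : ℕ → ℕ
    gT t = bit (T (e t))
    gS : ℕ → ℕ
    gS t = bit (Sf (e t))

    sumTx : sumBelow (suc (suc L)) (λ t → gT (suc t)) ≡ ⌊ suc (suc L) /2⌋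
    sumTx = trans (sumBelow-ext (suc (suc L)) (λ t lt → cong bit (trans (cong T (eS t (≤-pred lt))) (Tx t (≤-pred lt))))) (sumBelow-odd _)

    ΣT : sumBelow m gT ≡ suc (suc ⌊ suc (suc L) /2⌋)
    ΣT = trans (sumBelow-shift (suc (suc (suc L))) gT) (cong₂ _+_ (cong bit Tℓa)
           (trans (cong₂ _+_ sumTx (cong bit (trans (cong T eL) Tℓb))) (+-comm _ 1)))

    Sℓa : Sf ℓa ≡ false
    Sℓa = independent-edge IS ha Sx0
    Sx1 : Sf (x 1) ≡ false
    Sx1 = independent-edge IS (C⊆G (edge 0)) Sx0

    path : sumBelow (suc L) (λ t → gS (suc (suc (suc t)))) ≤ ⌊ suc (suc L) /2⌋
    path = pathIndependentBound (suc L) (λ t → Sf (e (suc (suc (suc t))))) (λ t lt h → independent-edge IS (eadj (suc (suc (suc t))) (s≤s (s≤s (s≤s (s≤s (≤-pred lt)))))) h)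

    ΣS : suc (sumBelow m gS) ≤ sumBelow m gT
    ΣS = subst (suc (sumBelow m gS) ≤_) (sym ΣT) (s≤s (≤-trans (≤-reflexive eqS) (s≤s path)))
      where
      eqS : sumBelow m gS ≡ suc (sumBelow (suc L) (λ t → gS (suc (suc (suc t)))))
      eqS = trans (sumBelow-shift (suc (suc (suc L))) gS)
            (trans (cong₂ _+_ (cong bit Sℓa) (sumBelow-shift (suc (suc L)) (λ t → gS (suc t))))
            (trans (cong₂ _+_ (cong bit (trans (cong Sf (eS 0 z≤n)) Sx0)) (sumBelow-shift (suc L) (λ t → gS (suc (suc t)))))
                   (cong (λ w → suc (w + sumBelow (suc L) (λ t → gS (suc (suc (suc t)))))) (trans (cong (λ w → bit (Sf w)) (eS 1 (s≤s z≤n))) (cong bit Sx1)))))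

    Tel : ∀ {u} → T u ≡ true → (Sf u ≡ true × inRange e m u ≡ false) ⊎ (u ≡ ℓa ⊎ (u ≡ ℓb ⊎ ∃[ i ] (i < suc L × odd i ≡ true × x i ≡ u)))
    Tel {u} h with ∨-elim {Sf u ∧ not (inRange e m u)} h
    ... | inj₁ q = inj₁ (∧-true₁ q , not-true (∧-true₂ q))
    ... | inj₂ q with ∨-elim {eqb u ℓa} q
    ...   | inj₁ q1 = inj₂ (inj₁ (eqb-true q1))
    ...   | inj₂ q2 with ∨-elim {eqb u ℓb} q2
    ...     | inj₁ q3 = inj₂ (inj₂ (inj₁ (eqb-true q3)))
    ...     | inj₂ q4 = let (j , lj , r) = anyBelow-elim {suc L} (λ j → odd j ∧ eqb (x j) u) q4 in inj₂ (inj₂ (inj₂ (j , lj , ∧-true₁ r , eqb-true (∧-true₂ r))))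

    newBad : ∀ {u z} → (u ≡ ℓa ⊎ (u ≡ ℓb ⊎ ∃[ i ] (i < suc L × odd i ≡ true × x i ≡ u))) → adj G u z ≡ true → T z ≡ false
    newBad (inj₁ refl) h = trans (cong T (offCycle-uniqueNeighbour na h (adj-symmetric ha))) (Tx 0 z≤n)
    newBad (inj₂ (inj₁ refl)) h = trans (cong T (offCycle-uniqueNeighbour nb h (adj-symmetric hb))) (trans (Tx (suc L) ≤-refl) oddSL)
    newBad {z = z} (inj₂ (inj₂ (zero , _ , o , _))) h = ⊥-elim (true≢false (sym o))
    newBad {z = z} (inj₂ (inj₂ (suc i , li , o , refl))) h
      with C-neighbours i z (adj⇒cycleEdge (onCycle-enumerated E (suc i)) (nl (suc i) (s≤s z≤n) (≤-pred li) z h) h)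
    ... | inj₁ q = trans (cong T q) (trans (Tx (suc (suc i)) li) (cong not o))
    ... | inj₂ q = trans (cong T q) (trans (Tx i (≤-trans (n≤1+n i) (<⇒≤ li))) (not-true o))

    IT : Independentᵇ T
    IT u z hu hz = ¬-not λ h → go (Tel hu) (Tel hz) h
      where
      go : _ → _ → adj G u z ≡ true → ⊥
      go (inj₁ (su , _)) (inj₁ (sz , _)) h = true≢false (trans (sym h) (IS u z su sz))
      go (inj₂ nu) _ h = true≢false (trans (sym hz) (newBad nu h))
      go (inj₁ _) (inj₂ nz) h = true≢false (trans (sym hu) (newBad nz (adj-symmetric h)))

    absurd : ⊥
    absurd = noImprovingSwap mx T IT e m De agree ΣS

  -- If x 0 ∈ S is the only legged cycle vertex, swapping S on ℓa and C for ℓa and the odd-indexed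
  -- x i gains a vertex.
  module SingleLeggedVertex {u0 v0 : Fin n} (E : Enumeration u0 v0) (S : Subset n) (mx : MaximumIndependent G S)
     (Sx0 : lookup S (Enumeration.x E 0) ≡ true)
     (ℓa : Fin n) (na : ¬ OnCycle C ℓa) (ha : adj G (Enumeration.x E 0) ℓa ≡ true)
     (nl : ∀ t → 1 ≤ t → t < Enumeration.k E → Leafless (Enumeration.x E t))
     (q : ℕ) (kq : Enumeration.k E ≡ suc (suc (suc q))) where
    open EnumerationLemmas E

    Sf : Fin n → Bool
    Sf = lookup S
    IS : Independentᵇ Sf
    IS = independentᵇ-lookup {S} (proj₁ mx)

    e : ℕ → Fin n
    e zero = ℓa
    e (suc i) = x i

    m : ℕ
    m = suc k

    xa : ∀ i → ¬ x i ≡ ℓa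
    xa i = onCycle⇒≢offCycle (onCycle-enumerated E i) na

    De : Distinct e m
    De zero zero _ _ _ = refl
    De zero (suc j) _ _ r = ⊥-elim (xa j (sym r))
    De (suc i) zero _ _ r = ⊥-elim (xa i r)
    De (suc i) (suc j) li lj r = cong suc (D i j (≤-pred li) (≤-pred lj) r)

    T : Fin n → Bool
    T z = (Sf z ∧ not (inRange e m z)) ∨ (eqb z ℓa ∨ anyBelow k (λ i → odd i ∧ eqb (x i) z))

    inW : ∀ i → i < k → inRange e m (x i) ≡ true
    inW i lt = inRange-intro e (suc i) (s≤s lt)

    Tx : ∀ i → i < k → T (x i) ≡ odd i
    Tx i lt = bool-ext f g
      where
      f : T (x i) ≡ true → odd i ≡ true
      f h with ∨-elim {Sf (x i) ∧ not (inRange e m (x i))} h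
      ... | inj₁ r = ⊥-elim (true≢false (trans (sym (∧-true₂ r)) (cong not (inW i lt))))
      ... | inj₂ r with ∨-elim {eqb (x i) ℓa} r
      ...   | inj₁ r1 = ⊥-elim (xa i (eqb-true r1))
      ...   | inj₂ r2 = let (j , lj , r') = anyBelow-elim {k} (λ j → odd j ∧ eqb (x j) (x i)) r2 in
                  subst (λ w → odd w ≡ true) (D j i lj lt (eqb-true (∧-true₂ r'))) (∧-true₁ r')
      g : odd i ≡ true → T (x i) ≡ true
      g o = ∨-intror {Sf (x i) ∧ not (inRange e m (x i))} (∨-intror {eqb (x i) ℓa}
             (anyBelow-intro (λ j → odd j ∧ eqb (x j) (x i)) i lt (∧-intro o (eqb-refl (x i)))))

    Tℓa : T ℓa ≡ true
    Tℓa = ∨-intror {Sf ℓa ∧ not (inRange e m ℓa)} (∨-introl (eqb-refl ℓa))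

    agree : ∀ z → inRange e m z ≡ false → Sf z ≡ T z
    agree z h = sym (trans (cong₂ (λ a b → (Sf z ∧ not (inRange e m z)) ∨ (a ∨ b)) (eqb-false (λ r → inRange-false {e = e} {m = m} h 0 (s≤s z≤n) (sym r)))
             (¬-not λ r → let (j , lj , r') = anyBelow-elim {k} (λ j → odd j ∧ eqb (x j) z) r in
                inRange-false {e = e} {m = m} h (suc j) (s≤s lj) (eqb-true (∧-true₂ r'))))
         (trans (cong (λ w → (Sf z ∧ not w) ∨ false) h) (trans (BP.∨-identityʳ _) (BP.∧-identityʳ (Sf z)))))

    gT : ℕ → ℕ
    gT t = bit (T (e t))
    gS : ℕ → ℕ
    gS t = bit (Sf (e t))
    g : ℕ → ℕ
    g t = bit (Sf (x t))

    ΣT : sumBelow m gT ≡ suc (suc ⌊ suc q /2⌋)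
    ΣT = trans (sumBelow-shift k gT) (cong₂ _+_ (cong bit Tℓa)
           (trans (sumBelow-ext k (λ t lt → cong bit (Tx t lt))) (trans (sumBelow-odd k) (cong ⌊_/2⌋ kq))))

    Sℓa : Sf ℓa ≡ false
    Sℓa = independent-edge IS ha Sx0
    Sx1 : Sf (x 1) ≡ false
    Sx1 = independent-edge IS (C⊆G (edge 0)) Sx0
    Slast : Sf (x (suc (suc q))) ≡ false
    Slast = independent-edge IS (adj-symmetric (subst (λ w → adj G (x (suc (suc q))) w ≡ true) (trans (cong x (sym kq)) xk) (C⊆G (edge (suc (suc q)))))) Sx0

    path : sumBelow q (λ t → g (suc (suc t))) ≤ ⌊ suc q /2⌋
    path = pathIndependentBound q (λ t → Sf (x (suc (suc t)))) (λ t lt h → independent-edge IS (C⊆G (edge (suc (suc t)))) h)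

    ΣS : suc (sumBelow m gS) ≤ sumBelow m gT
    ΣS = subst (suc (sumBelow m gS) ≤_) (sym ΣT) (s≤s (≤-trans (≤-reflexive eqS) (s≤s (≤-trans (≤-reflexive (+-identityʳ _)) path))))
      where
      eqS : sumBelow m gS ≡ suc (sumBelow q (λ t → g (suc (suc t))) + 0)
      eqS = trans (sumBelow-shift k gS) (trans (cong₂ _+_ (cong bit Sℓa) (cong (λ w → sumBelow w g) kq))
            (trans (sumBelow-shift (suc (suc q)) g) (trans (cong₂ _+_ (cong bit Sx0) (sumBelow-shift (suc q) (λ t → g (suc t))))
              (cong suc (trans (cong₂ _+_ (cong bit Sx1) refl) (cong (sumBelow q (λ t → g (suc (suc t))) +_) (cong bit Slast)))))))

    Tel : ∀ {u} → T u ≡ true → (Sf u ≡ true × inRange e m u ≡ false) ⊎ (u ≡ ℓa ⊎ ∃[ i ] (i < k × odd i ≡ true × x i ≡ u))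
    Tel {u} h with ∨-elim {Sf u ∧ not (inRange e m u)} h
    ... | inj₁ r = inj₁ (∧-true₁ r , not-true (∧-true₂ r))
    ... | inj₂ r with ∨-elim {eqb u ℓa} r
    ...   | inj₁ r1 = inj₂ (inj₁ (eqb-true r1))
    ...   | inj₂ r2 = let (j , lj , r') = anyBelow-elim {k} (λ j → odd j ∧ eqb (x j) u) r2 in inj₂ (inj₂ (j , lj , ∧-true₁ r' , eqb-true (∧-true₂ r')))

    newBad : ∀ {u z} → (u ≡ ℓa ⊎ ∃[ i ] (i < k × odd i ≡ true × x i ≡ u)) → adj G u z ≡ true → T z ≡ false
    newBad (inj₁ refl) h = trans (cong T (offCycle-uniqueNeighbour na h (adj-symmetric ha))) (Tx 0 lt0)
    newBad (inj₂ (zero , _ , o , _)) h = ⊥-elim (true≢false (sym o))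
    newBad {z = z} (inj₂ (suc i , li , o , refl)) h with nl (suc i) (s≤s z≤n) li z h
    ... | oz with C-neighbours i z (adj⇒cycleEdge (onCycle-enumerated E (suc i)) oz h)
    ...   | inj₂ r = trans (cong T r) (trans (Tx i (<-trans (n<1+n i) li)) (not-true o))
    ...   | inj₁ r with m≤n⇒m<n∨m≡n li
    ...     | inj₁ sl = trans (cong T r) (trans (Tx (suc (suc i)) sl) (cong not o))
    ...     | inj₂ el = trans (cong T (trans r (trans (cong x el) xk))) (Tx 0 lt0)

    IT : Independentᵇ T
    IT u z hu hz = ¬-not λ h → go (Tel hu) (Tel hz) h
      where
      go : _ → _ → adj G u z ≡ true → ⊥
      go (inj₁ (su , _)) (inj₁ (sz , _)) h = true≢false (trans (sym h) (IS u z su sz))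
      go (inj₂ nu) _ h = true≢false (trans (sym hz) (newBad nu h))
      go (inj₁ _) (inj₂ nz) h = true≢false (trans (sym hu) (newBad nz (adj-symmetric h)))

    absurd : ⊥
    absurd = noImprovingSwap mx T IT e m De agree ΣS

  hasLeaf? : ∀ c → Dec (∃[ w ] (adj G c w ≡ true × ¬ OnCycle C w))
  hasLeaf? c = any? (λ w → (adj G c w BP.≟ true) ×-dec ¬? (onCycle? w))

  hasLeafᵇ : Fin n → Bool
  hasLeafᵇ c = does (hasLeaf? c)

  hasLeafᵇ⇒leaf : ∀ {c} → hasLeafᵇ c ≡ true → ∃[ w ] (adj G c w ≡ true × ¬ OnCycle C w)
  hasLeafᵇ⇒leaf {c} e with hasLeaf? c
  ... | yes p = p

  leaf⇒hasLeafᵇ : ∀ {c w} → adj G c w ≡ true → ¬ OnCycle C w → hasLeafᵇ c ≡ true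
  leaf⇒hasLeafᵇ {c} {w} h nw with hasLeaf? c
  ... | yes _ = refl
  ... | no p = ⊥-elim (p (w , h , nw))

  ¬hasLeafᵇ⇒leafless : ∀ {c} → hasLeafᵇ c ≡ false → Leafless c
  ¬hasLeafᵇ⇒leafless {c} e w h with onCycle? w
  ... | yes p = p
  ... | no p = ⊥-elim (true≢false (trans (sym (leaf⇒hasLeafᵇ h p)) e))

  module GivenLeg (ex : AlphaExcellent G) (ℓ0 c0 : Fin n) (n0 : ¬ OnCycle C ℓ0) (h0 : adj G ℓ0 c0 ≡ true) where

    oc0 : OnCycle C c0
    oc0 = offCycle-neighbourOnCycle n0 h0
    E : Enumeration c0 (proj₁ oc0)
    E = enumerate c0 (proj₁ oc0) (proj₂ oc0)
    open EnumerationLemmas E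

    hasLeafᵇ-x0 : hasLeafᵇ (x 0) ≡ true
    hasLeafᵇ-x0 = leaf⇒hasLeafᵇ (subst (λ q → adj G q ℓ0 ≡ true) (sym x0) (adj-symmetric h0)) n0

    excellentAt : ∀ z → ∃[ S ] (MaximumIndependent G S × lookup S z ≡ true)
    excellentAt z = let (S , mx , m) = ex z in S , mx , ∈-vec m

    secondLegged? : Dec (∃[ z ] ((hasLeafᵇ z ≡ true × OnCycle C z) × ¬ z ≡ c0))
    secondLegged? = any? (λ z → ((hasLeafᵇ z BP.≟ true) ×-dec onCycle? z) ×-dec ¬? (z ≟ c0))

    secondLegged : ¬ (∃[ z ] ((hasLeafᵇ z ≡ true × OnCycle C z) × ¬ z ≡ c0)) → ⊥
    secondLegged no1 = let (S , mx , Sx0) = excellentAt (x 0) in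
      SingleLeggedVertex.absurd E S mx Sx0 ℓ0 n0 (subst (λ q → adj G q ℓ0 ≡ true) (sym x0) (adj-symmetric h0)) nl (k ∸ 3) kq
      where
      nl : ∀ t → 1 ≤ t → t < k → Leafless (x t)
      nl t 1≤t lt w h with onCycle? w
      ... | yes p = p
      ... | no p = ⊥-elim (no1 (x t , (leaf⇒hasLeafᵇ h p , onCycle-enumerated E t) , λ q → <-irrefl (D 0 t lt0 lt (trans x0 (sym q))) 1≤t))
      kq : k ≡ suc (suc (suc (k ∸ 3)))
      kq = sym (trans (+-comm 3 (k ∸ 3)) (m∸n+n≡m k≥3))

    -- Whether the cycle edge x t x (t + 1) is matched: matched edges alternate along every leafless
    -- stretch, starting afresh after each legged vertex.
    matchedAt : ℕ → Bool
    matchedAt zero = false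
    matchedAt (suc t) = not (hasLeafᵇ (x (suc t))) ∧ not (matchedAt t)

    lastLegBefore : ∀ t → ∃[ s ] (s ≤ t × hasLeafᵇ (x s) ≡ true × (∀ i → s < i → i ≤ t → hasLeafᵇ (x i) ≡ false) × matchedAt t ≡ odd (t ∸ s))
    lastLegBefore zero = 0 , z≤n , hasLeafᵇ-x0 , (λ i si it → ⊥-elim (<-irrefl refl (<-≤-trans si it))) , refl
    lastLegBefore (suc t) with hasLeafᵇ (x (suc t)) in eh
    ... | true = suc t , ≤-refl , eh , (λ i si it → ⊥-elim (<-irrefl refl (<-≤-trans si it))) , cong odd (sym (n∸n≡0 (suc t)))
    ... | false with lastLegBefore t
    ... | s , st , hs , gap , ft = s , ≤-trans st (n≤1+n t) , hs , gap' , trans (cong not ft) (cong odd (sym (+-∸-assoc 1 st)))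
      where
      gap' : ∀ i → s < i → i ≤ suc t → hasLeafᵇ (x i) ≡ false
      gap' i si it with m≤n⇒m<n∨m≡n it
      ... | inj₁ q = gap i si (≤-pred q)
      ... | inj₂ refl = eh

    module TwoLeggedVertices (c1 : Fin n) (hc1 : hasLeafᵇ c1 ≡ true) (oc1 : OnCycle C c1) (c10 : ¬ c1 ≡ c0) where

      Gap : ℕ → ℕ → Set
      Gap s t = ∀ i → s < i → i ≤ t → hasLeafᵇ (x i) ≡ false

      noOddGapAt : ∀ s t → s ≤ t → hasLeafᵇ (x s) ≡ true → Gap s t → odd (t ∸ s) ≡ true → suc (t ∸ s) < k → hasLeafᵇ (x (suc t)) ≡ true → ⊥
      noOddGapAt s t st hs gap oL lk hb with excellentAt (x s) | hasLeafᵇ⇒leaf hs | hasLeafᵇ⇒leaf hb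
      ... | S , mx , s∈S | ℓa , haℓ , na | ℓb , hbℓ , nb =
        OddGapBetweenLegs.absurd (shift s) S mx Sx0' ℓa na ha' (t ∸ s) oL lk ℓb nb hb' nl
        where
        s0 : x (s + 0) ≡ x s
        s0 = cong x (+-identityʳ s)
        Sx0' : lookup S (x (s + 0)) ≡ true
        Sx0' = trans (cong (lookup S) s0) s∈S
        ha' : adj G (x (s + 0)) ℓa ≡ true
        ha' = trans (cong (λ q → adj G q ℓa) s0) haℓ
        sL : s + suc (t ∸ s) ≡ suc t
        sL = trans (+-suc s (t ∸ s)) (cong suc (m+[n∸m]≡n st))
        hb' : adj G (x (s + suc (t ∸ s))) ℓb ≡ true
        hb' = trans (cong (λ q → adj G (x q) ℓb) sL) hbℓ
        nl : ∀ i → 1 ≤ i → i ≤ t ∸ s → Leafless (x (s + i))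
        nl i 1i iL = ¬hasLeafᵇ⇒leafless (gap (s + i) (subst (_≤ s + i) (+-comm s 1) (+-monoʳ-≤ s 1i))
                         (≤-trans (+-monoʳ-≤ s iL) (≤-reflexive (m+[n∸m]≡n st))))

      noOddGap : ∀ s t → s ≤ t → hasLeafᵇ (x s) ≡ true → Gap s t → odd (t ∸ s) ≡ true → hasLeafᵇ (x (suc t)) ≡ true → suc t < k ⊎ suc t ≡ k → ⊥
      noOddGap zero t st hs gap oL hb (inj₂ e) = let (r , lr , xr) = indexOf c1 oc1 in r≠ r lr xr
        where
        r≠ : ∀ r → r < k → x r ≡ c1 → ⊥
        r≠ zero _ xr = c10 (trans (sym xr) x0)
        r≠ (suc r) lr xr = true≢false (trans (sym hc1) (trans (cong hasLeafᵇ (sym xr)) (gap (suc r) (s≤s z≤n) (≤-pred (subst (suc r <_) (sym e) lr)))))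
      noOddGap zero t st hs gap oL hb (inj₁ sl) = noOddGapAt 0 t st hs gap oL sl hb
      noOddGap (suc s') t st hs gap oL hb (inj₁ sl) = noOddGapAt (suc s') t st hs gap oL (≤-<-trans (s≤s (m∸n≤m t (suc s'))) sl) hb
      noOddGap (suc s') t st hs gap oL hb (inj₂ e) = noOddGapAt (suc s') t st hs gap oL (subst (suc (t ∸ suc s') <_) e (s≤s (∸-monoʳ-< {t} {suc s'} {0} (s≤s z≤n) st))) hb

      matchedAt⇒nextLeafless : ∀ t → t < k → matchedAt t ≡ true → suc t < k × hasLeafᵇ (x (suc t)) ≡ false
      matchedAt⇒nextLeafless t lt ft = let (s , st , hs , gap , fts) = lastLegBefore t in go s st hs gap (trans (sym fts) ft) (m≤n⇒m<n∨m≡n lt)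
        where
        go : ∀ s → s ≤ t → hasLeafᵇ (x s) ≡ true → Gap s t → odd (t ∸ s) ≡ true → suc t < k ⊎ suc t ≡ k → suc t < k × hasLeafᵇ (x (suc t)) ≡ false
        go s st hs gap oL (inj₁ sl) with hasLeafᵇ (x (suc t)) in hb
        ... | false = sl , refl
        ... | true = ⊥-elim (noOddGap s t st hs gap oL hb (inj₁ sl))
        go s st hs gap oL (inj₂ e) = ⊥-elim (noOddGap s t st hs gap oL (trans (cong (λ q → hasLeafᵇ (x q)) e) (trans (cong hasLeafᵇ xk) hasLeafᵇ-x0)) (inj₂ e))

      matchedAt⇒leafless : ∀ t → matchedAt t ≡ true → hasLeafᵇ (x t) ≡ false
      matchedAt⇒leafless zero ()
      matchedAt⇒leafless (suc t) h = not-true (∧-true₁ {not (hasLeafᵇ (x (suc t)))} h)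

      matchedAt-alternates : ∀ t → hasLeafᵇ (x (suc t)) ≡ false → matchedAt (suc t) ≡ not (matchedAt t)
      matchedAt-alternates t e rewrite e = refl

      offCycleᵇ : Fin n → Bool
      offCycleᵇ u = not (onCycleᵇ u)

      matchedEdgeAt : Fin n → Fin n → ℕ → Bool
      matchedEdgeAt u v t = matchedAt t ∧ ((eqb (x t) u ∧ eqb (x (suc t)) v) ∨ (eqb (x (suc t)) u ∧ eqb (x t) v))

      M : Rel₂ n
      M u v = (offCycleᵇ u ∧ adj G u v) ∨ ((offCycleᵇ v ∧ adj G u v) ∨ anyBelow k (matchedEdgeAt u v))

      offCycle⇒offCycleᵇ : ∀ {u} → ¬ OnCycle C u → offCycleᵇ u ≡ true
      offCycle⇒offCycleᵇ nu = cong not (offCycle⇒onCycleᵇ-false nu)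

      offCycleᵇ⇒offCycle : ∀ {u} → offCycleᵇ u ≡ true → ¬ OnCycle C u
      offCycleᵇ⇒offCycle {u} e = onCycleᵇ-false (not-true e)

      M-leafEdgeˡ : ∀ {u v} → ¬ OnCycle C u → adj G u v ≡ true → M u v ≡ true
      M-leafEdgeˡ nu h = ∨-introl (∧-intro (offCycle⇒offCycleᵇ nu) h)
      M-leafEdgeʳ : ∀ {u v} → ¬ OnCycle C v → adj G u v ≡ true → M u v ≡ true
      M-leafEdgeʳ {u} {v} nv h = ∨-intror {offCycleᵇ u ∧ adj G u v} (∨-introl (∧-intro (offCycle⇒offCycleᵇ nv) h))
      M-cycleEdge : ∀ {u v} t → t < k → matchedAt t ≡ true → x t ≡ u → x (suc t) ≡ v → M u v ≡ true
      M-cycleEdge {u} {v} t lt ft p q = ∨-intror {offCycleᵇ u ∧ adj G u v} (∨-intror {offCycleᵇ v ∧ adj G u v}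
        (anyBelow-intro (matchedEdgeAt u v) t lt (∧-intro ft (∨-introl (∧-intro (≡⇒eqb p) (≡⇒eqb q))))))
      M-cycleEdge′ : ∀ {u v} t → t < k → matchedAt t ≡ true → x (suc t) ≡ u → x t ≡ v → M u v ≡ true
      M-cycleEdge′ {u} {v} t lt ft p q = ∨-intror {offCycleᵇ u ∧ adj G u v} (∨-intror {offCycleᵇ v ∧ adj G u v}
        (anyBelow-intro (matchedEdgeAt u v) t lt (∧-intro ft (∨-intror {eqb (x t) u ∧ eqb (x (suc t)) v} (∧-intro (≡⇒eqb p) (≡⇒eqb q))))))

      data ViewM (u v : Fin n) : Set where
        leafˡ : ¬ OnCycle C u → adj G u v ≡ true → ViewM u v
        leafʳ : ¬ OnCycle C v → adj G u v ≡ true → ViewM u v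
        along : ∀ t → t < k → matchedAt t ≡ true → x t ≡ u → x (suc t) ≡ v → ViewM u v
        along′ : ∀ t → t < k → matchedAt t ≡ true → x (suc t) ≡ u → x t ≡ v → ViewM u v

      viewM : ∀ {u v} → M u v ≡ true → ViewM u v
      viewM {u} {v} h with ∨-elim {offCycleᵇ u ∧ adj G u v} h
      ... | inj₁ q = leafˡ (offCycleᵇ⇒offCycle (∧-true₁ q)) (∧-true₂ q)
      ... | inj₂ q with ∨-elim {offCycleᵇ v ∧ adj G u v} q
      ...   | inj₁ q1 = leafʳ (offCycleᵇ⇒offCycle (∧-true₁ q1)) (∧-true₂ q1)
      ...   | inj₂ q2 with anyBelow-elim {k} (matchedEdgeAt u v) q2
      ...     | t , lt , r with ∨-elim {eqb (x t) u ∧ eqb (x (suc t)) v} (∧-true₂ r)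
      ...       | inj₁ a = along t lt (∧-true₁ r) (eqb-true (∧-true₁ a)) (eqb-true (∧-true₂ a))
      ...       | inj₂ b = along′ t lt (∧-true₁ r) (eqb-true (∧-true₁ b)) (eqb-true (∧-true₂ b))

      M-symmetric : ∀ {u v} → M u v ≡ true → M v u ≡ true
      M-symmetric h with viewM h
      ... | leafˡ nu a = M-leafEdgeʳ nu (adj-symmetric a)
      ... | leafʳ nv a = M-leafEdgeˡ nv (adj-symmetric a)
      ... | along t lt ft p q = M-cycleEdge′ t lt ft q p
      ... | along′ t lt ft p q = M-cycleEdge t lt ft q p

      M⊆G : ∀ {u v} → M u v ≡ true → adj G u v ≡ true
      M⊆G h with viewM h
      ... | leafˡ _ a = a
      ... | leafʳ _ a = a
      ... | along t _ _ p q = subst₂ (λ a b → adj G a b ≡ true) p q (C⊆G (edge t))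
      ... | along′ t _ _ p q = subst₂ (λ a b → adj G a b ≡ true) p q (adj-symmetric (C⊆G (edge t)))

      M-subEdges : SubEdges G M
      M-subEdges = record { symH = λ u v → bool-ext M-symmetric M-symmetric ; subH = λ u v → M⊆G }

      onCycle-x : ∀ {u t} → x t ≡ u → OnCycle C u
      onCycle-x {t = t} p = subst (OnCycle C) p (onCycle-enumerated E t)

      count-M-offCycle : ∀ {z} → ¬ OnCycle C z → count (M z) ≡ 1
      count-M-offCycle {z} nz = let (c , hc) = offCycle-hasNeighbour nz in count-one c (M-leafEdgeˡ nz hc) uq
        where
        uq : ∀ w → M z w ≡ true → w ≡ proj₁ (offCycle-hasNeighbour nz)
        uq w h with viewM h
        ... | leafˡ _ a = offCycle-uniqueNeighbour nz a (proj₂ (offCycle-hasNeighbour nz))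
        ... | leafʳ nw a = ⊥-elim (nw (offCycle-neighbourOnCycle nz a))
        ... | along t _ _ p _ = ⊥-elim (nz (onCycle-x p))
        ... | along′ t _ _ p _ = ⊥-elim (nz (onCycle-x p))

      count-M-legged : ∀ {z} → OnCycle C z → hasLeafᵇ z ≡ true → count (M z) ≡ 1
      count-M-legged {z} oz hz = let (ℓ , hℓ , nℓ) = hasLeafᵇ⇒leaf hz in count-one ℓ (M-leafEdgeʳ nℓ hℓ) (uq ℓ hℓ nℓ)
        where
        uq : ∀ ℓ → adj G z ℓ ≡ true → ¬ OnCycle C ℓ → ∀ w → M z w ≡ true → w ≡ ℓ
        uq ℓ hℓ nℓ w h with viewM h
        ... | leafˡ nz _ = ⊥-elim (nz oz)
        ... | leafʳ nw a = excellent⇒leafUnique ex nw nℓ a hℓ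
        ... | along t _ ft p _ = ⊥-elim (true≢false (trans (sym hz) (trans (cong hasLeafᵇ (sym p)) (matchedAt⇒leafless t ft))))
        ... | along′ t lt ft p _ = ⊥-elim (true≢false (trans (sym hz) (trans (cong hasLeafᵇ (sym p)) (proj₂ (matchedAt⇒nextLeafless t lt ft)))))

      count-M-leafless : ∀ {z} → OnCycle C z → hasLeafᵇ z ≡ false → count (M z) ≡ 1
      count-M-leafless {z} oz hz with indexOf z oz
      ... | zero , _ , xt = ⊥-elim (true≢false (trans (sym hasLeafᵇ-x0) (trans (cong hasLeafᵇ xt) hz)))
      ... | suc t' , lt , xt = sub (matchedAt (suc t')) refl
        where
        hx : hasLeafᵇ (x (suc t')) ≡ false
        hx = trans (cong hasLeafᵇ xt) hz
        step' : matchedAt (suc t') ≡ not (matchedAt t')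
        step' = matchedAt-alternates t' hx
        lt' : t' < k
        lt' = <-trans (n<1+n t') lt
        sub : ∀ b → matchedAt (suc t') ≡ b → count (M z) ≡ 1
        sub true fe = count-one (x (suc (suc t'))) (M-cycleEdge (suc t') lt fe xt refl) uq
          where
          uq : ∀ w → M z w ≡ true → w ≡ x (suc (suc t'))
          uq w h with viewM h
          ... | leafˡ nz _ = ⊥-elim (nz oz)
          ... | leafʳ nw a = ⊥-elim (true≢false (trans (sym (leaf⇒hasLeafᵇ a nw)) hz))
          ... | along s ls fs p q with D s (suc t') ls lt (trans p (sym xt))
          ...   | refl = sym q
          uq w h | along′ s ls fs p q with D (suc s) (suc t') (proj₁ (matchedAt⇒nextLeafless s ls fs)) lt (trans p (sym xt))
          ...   | refl = ⊥-elim (true≢false (trans (sym fe) (trans step' (cong not fs))))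
        sub false fe = count-one (x t') (M-cycleEdge′ t' lt' ft' xt refl) uq
          where
          ft' : matchedAt t' ≡ true
          ft' = not-false⁻¹ (trans (sym step') fe)
          uq : ∀ w → M z w ≡ true → w ≡ x t'
          uq w h with viewM h
          ... | leafˡ nz _ = ⊥-elim (nz oz)
          ... | leafʳ nw a = ⊥-elim (true≢false (trans (sym (leaf⇒hasLeafᵇ a nw)) hz))
          ... | along s ls fs p q with D s (suc t') ls lt (trans p (sym xt))
          ...   | refl = ⊥-elim (true≢false (trans (sym fs) fe))
          uq w h | along′ s ls fs p q with D (suc s) (suc t') (proj₁ (matchedAt⇒nextLeafless s ls fs)) lt (trans p (sym xt))
          ...   | refl = sym q

      deg-M : ∀ z → deg M z ≡ 1
      deg-M z = trans (card-tab (M z)) (byCase (onCycle? z))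
        where
        byCase : Dec (OnCycle C z) → count (M z) ≡ 1
        byCase (no nz) = count-M-offCycle nz
        byCase (yes oz) with hasLeafᵇ z in hz
        ... | true = count-M-legged oz hz
        ... | false = count-M-leafless oz hz

      perfectMatching : HasPerfectMatching G
      perfectMatching = M , M-subEdges , deg-M

      atLeastTwoLegs : AtLeastTwoLegs G
      atLeastTwoLegs = let (ℓ1 , h1 , n1) = hasLeafᵇ⇒leaf hc1 in
        ℓ0 , c0 , ℓ1 , c1 , (h0 , inj₁ (offCycle⇒deg≡1 n0)) , (adj-symmetric h1 , inj₁ (offCycle⇒deg≡1 n1)) ,
        (λ { (_ , e) → c10 (sym e) }) , (λ { (e , _) → onCycle⇒≢offCycle oc1 n0 (sym e) })

  alphaExcellent⇒noLeg⊎matching×legs : AlphaExcellent G → NoLeg G ⊎ (HasPerfectMatching G × AtLeastTwoLegs G)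
  alphaExcellent⇒noLeg⊎matching×legs ex with any? (λ z → ¬? (onCycle? z))
  ... | no none = inj₁ (λ u v L → go u v (leg-offCycleEnd L))
    where go : ∀ u v → (¬ OnCycle C u × OnCycle C v) ⊎ (¬ OnCycle C v × OnCycle C u) → ⊥
          go u v (inj₁ (nu , _)) = none (u , nu)
          go u v (inj₂ (nv , _)) = none (v , nv)
  ... | yes (ℓ0 , n0) = let (c0 , h0) = offCycle-hasNeighbour n0 in withNeighbour c0 h0
    where
    withNeighbour : ∀ c0 → adj G ℓ0 c0 ≡ true → NoLeg G ⊎ (HasPerfectMatching G × AtLeastTwoLegs G)
    withNeighbour c0 h0 with GivenLeg.secondLegged? ex ℓ0 c0 n0 h0
    ... | no no1 = ⊥-elim (GivenLeg.secondLegged ex ℓ0 c0 n0 h0 no1)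
    ... | yes (c1 , (hc1 , oc1) , c10) = inj₂ (KK.perfectMatching , KK.atLeastTwoLegs)
      where module KK = GivenLeg.TwoLeggedVertices ex ℓ0 c0 n0 h0 c1 hc1 oc1 c10

proposition3p1 : {n : ℕ} (G : Graph n) (C : Rel₂ n) → CaterpillarWheel G C →
    AlphaExcellent G ⇔ (NoLeg G ⊎ (HasPerfectMatching G × AtLeastTwoLegs G))
proposition3p1 G C cw =
  mk⇔ alphaExcellent⇒noLeg⊎matching×legs [ noLeg⇒alphaExcellent , uncurry matching⇒legs⇒alphaExcellent ]′
  where open CaterpillarWheelLemmas G C cw
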